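{- For every Klee-graph $G$, the graph $\mathcal{F}(G,\mathbb{Z}_4)$ is a perfect matching on $6$ vertices (i.e., it has exactly $6$ vertices, each of degree exactly $1$).
   Context: Klee-graphs are defined recursively: $K_4$ is a Klee-graph, and if $H$ is a Klee-graph and $v$ is a vertex of $H$ with neighbors $u_1,u_2,u_3$, then the graph obtained by deleting $v$, adding three new pairwise adjacent vertices $v_1,v_2,v_3$, and adding the edges $u_iv_i$ for $1\le i\le 3$, is a Klee-graph. Fix an orientation of $G$. A $\mathbb{Z}_4$-flow is a map $f:E(G)\to\mathbb{Z}_4$ such that at each vertex the sum of values on outgoing arcs equals the sum on incoming arcs; nowhere-zero means no edge receives $0$. A cycle is a connected 2-regular subgraph. $\mathcal{F}(G,\mathbb{Z}_4)$ is the graph whose vertices are the nowhere-zero $\mathbb{Z}_4$-flows of $G$, two flows $f,g$ adjacent iff $\{e:(f-g)(e)\ne0\}$ is the edge set of a cycle. -}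

module Defs where

open import Data.Nat using (ℕ; zero; suc; _+_; _%_)
open import Data.Bool using (Bool; true; false; if_then_else_; not)
open import Data.Fin using (Fin; zero; suc; toℕ; _≟_)
open import Data.Fin.Permutation using (Permutation′; _⟨$⟩ʳ_)
open import Data.Product using (Σ; ∃; ∃-syntax; _×_; _,_; proj₁; proj₂)
open import Data.Sum using (_⊎_)
open import Data.List using (List; []; _∷_; _++_; map; length)
import Data.List as List
open import Data.List.Relation.Binary.Permutation.Propositional using (_↭_)
open import Data.List.Relation.Binary.Pointwise using (Pointwise)
open import Data.Vec using (Vec; tabulate; lookup)
import Data.Vec as Vec
open import Relation.Nullary using (¬_; does)
open import Relation.Binary.PropositionalEquality using (_≡_; _≢_)

-- Oriented graphs: vertex set Fin n, edges an (indexed) list of arcs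
-- (tail , head).  The list position is the edge identity.

Edges : ℕ → Set
Edges n = List (Fin n × Fin n)

K4 : Edges 4
K4 = (v0 , v1) ∷ (v0 , v2) ∷ (v0 , v3) ∷ (v1 , v2) ∷ (v1 , v3) ∷ (v2 , v3) ∷ []
  where
  v0 v1 v2 v3 : Fin 4
  v0 = zero
  v1 = suc zero
  v2 = suc (suc zero)
  v3 = suc (suc (suc zero))

-- Expansion of vertex v into a triangle.  Old vertex x becomes suc (suc x);
-- v itself becomes v₁ = suc (suc v), and the new vertices are v₂ = zero,
-- v₃ = suc zero.  The k-th edge-end at v (k = 0,1,2) is reattached to v_{k+1}.
shift : ∀ {n} → Fin n → Fin (suc (suc n))
shift x = suc (suc x)

newV : ∀ {n} → Fin n → ℕ → Fin (suc (suc n))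
newV v zero = suc (suc v)
newV v (suc zero) = zero
newV v (suc (suc _)) = suc zero

expandGo : ∀ {n} → Fin n → ℕ → Edges n → Edges (suc (suc n))
expandGo v c [] = []
expandGo v c ((a , b) ∷ es) with does (a ≟ v) | does (b ≟ v)
... | true  | true  = (newV v c , newV v (suc c)) ∷ expandGo v (suc (suc c)) es
... | true  | false = (newV v c , shift b) ∷ expandGo v (suc c) es
... | false | true  = (shift a , newV v c) ∷ expandGo v (suc c) es
... | false | false = (shift a , shift b) ∷ expandGo v c es

expandEdges : ∀ {n} → Fin n → Edges n → Edges (suc (suc n))
expandEdges v es =
  expandGo v 0 es ++
  ((shift v , zero) ∷ (zero , suc zero) ∷ (suc zero , shift v) ∷ [])

relabelEdges : ∀ {n} → Permutation′ n → Edges n → Edges n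
relabelEdges π = map (λ e → (π ⟨$⟩ʳ proj₁ e , π ⟨$⟩ʳ proj₂ e))

SameEdge : ∀ {n} → Fin n × Fin n → Fin n × Fin n → Set
SameEdge (a , b) e = e ≡ (a , b) ⊎ e ≡ (b , a)

data Klee : (n : ℕ) → Edges n → Set where
  k4      : Klee 4 K4
  expand  : ∀ {n es} → Klee n es → (v : Fin n) → Klee (suc (suc n)) (expandEdges v es)
  relabel : ∀ {n es} → Klee n es → (π : Permutation′ n) → Klee n (relabelEdges π es)
  reorder : ∀ {n es es′} → Klee n es → es ↭ es′ → Klee n es′
  reorient : ∀ {n es es′} → Klee n es → Pointwise SameEdge es es′ → Klee n es′

-- Z4-flows.  A Z4-value is an element of Fin 4 (read as ℤ/4ℤ);
-- a map E(G) → Z4 is a vector indexed by edge positions.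

module _ {n : ℕ} (es : Edges n) where

  Arc : Fin (length es) → Fin n × Fin n
  Arc i = List.lookup es i

  tl hd : Fin (length es) → Fin n
  tl i = proj₁ (Arc i)
  hd i = proj₂ (Arc i)

  Z4Map : Set
  Z4Map = Vec (Fin 4) (length es)

  sumN : ∀ {k} → Vec ℕ k → ℕ
  sumN = Vec.foldr _ _+_ 0

  outSum inSum : Z4Map → Fin n → ℕ
  outSum f x = sumN (tabulate λ i → if does (tl i ≟ x) then toℕ (lookup f i) else 0)
  inSum  f x = sumN (tabulate λ i → if does (hd i ≟ x) then toℕ (lookup f i) else 0)

  IsZ4Flow : Z4Map → Set
  IsZ4Flow f = ∀ x → outSum f x % 4 ≡ inSum f x % 4

  NowhereZero : Z4Map → Set
  NowhereZero f = ∀ i → lookup f i ≢ zero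

  NZFlow : Z4Map → Set
  NZFlow f = IsZ4Flow f × NowhereZero f

  EdgeSet : Set
  EdgeSet = Vec Bool (length es)

  InS : EdgeSet → Fin (length es) → Set
  InS S i = lookup S i ≡ true

  degIn : EdgeSet → Fin n → ℕ
  degIn S x = sumN (tabulate λ i →
    if lookup S i
      then (if does (tl i ≟ x) then 1 else 0) + (if does (hd i ≟ x) then 1 else 0)
      else 0)

  data Reach (S : EdgeSet) : Fin n → Fin n → Set where
    here : ∀ {x} → Reach S x x
    fwd  : ∀ {y} i → InS S i → Reach S (hd i) y → Reach S (tl i) y
    bwd  : ∀ {y} i → InS S i → Reach S (tl i) y → Reach S (hd i) y

  IsCycleEdgeSet : EdgeSet → Set
  IsCycleEdgeSet S =
    (∃[ i ] InS S i) ×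
    (∀ x → degIn S x ≡ 0 ⊎ degIn S x ≡ 2) ×
    (∀ i j → InS S i → InS S j → Reach S (tl i) (tl j))

  diffSupport : Z4Map → Z4Map → EdgeSet
  diffSupport f g = tabulate λ i → not (does (lookup f i ≟ lookup g i))

  FlowAdj : Z4Map → Z4Map → Set
  FlowAdj f g = IsCycleEdgeSet (diffSupport f g)

  FlowGraphHasVertices : ℕ → Set
  FlowGraphHasVertices k =
    Σ (Vec Z4Map k) λ L →
      (∀ a b → lookup L a ≡ lookup L b → a ≡ b) ×
      (∀ a → NZFlow (lookup L a)) ×
      (∀ f → NZFlow f → ∃[ a ] lookup L a ≡ f)

  FlowGraphOneRegular : Set
  FlowGraphOneRegular =
    ∀ f → NZFlow f →
      ∃[ g ] (NZFlow g × FlowAdj f g × (∀ h → NZFlow h → FlowAdj f h → h ≡ g))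

{-# OPTIONS --safe #-}
-- Induction over the construction of Klee graphs, with the invariant: the graph is cubic,
-- it has exactly six nowhere-zero ℤ₄-flows, and two of them are adjacent exactly when one
-- is the negation of the other. For K4 this is checked by computation, and it is
-- transported along isomorphisms.
--
-- When v is expanded into a triangle V₀V₁V₂, Kirchhoff's law at the triangle determines
-- the three triangle values from the flow on the old arcs (they are 1, 2, 3 in some
-- order), so restriction to the old arcs is a bijection of nowhere-zero flows that
-- commutes with negation. A cycle of the expanded graph contracts to a cycle of the
-- original one, so adjacency can only pair f with -f. Conversely f and -f differ exactly
-- on the odd arcs of f; in a cubic graph these form a 2-regular subgraph, and after the
-- expansion it is still connected: its contraction is a cycle by induction, and the two
-- odd triangle arcs join V₀, V₁ and V₂.

module Submission where

open import Defs
open import Algebra.Bundles using (CommutativeMonoid)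
import Algebra.Properties.CommutativeMonoid.Sum as MonoidSum
open import Data.Bool as Bool using (Bool; true; false; if_then_else_; not)
open import Data.Empty using (⊥-elim)
open import Data.Fin using (Fin; zero; suc; toℕ; _≟_)
open import Data.Fin.Patterns using (0F; 1F; 2F; 3F; 4F; 5F)
open import Data.Fin.Permutation as Perm using (Permutation; Permutation′; _⟨$⟩ʳ_; _⟨$⟩ˡ_)
open import Data.Fin.Properties using (all?; any?; ¬∀⟶∃¬; toℕ-fromℕ<; toℕ-injective; suc-injective)
open import Data.List using ([]; _∷_; _++_; length)
open import Data.List.Relation.Binary.Permutation.Propositional using (_↭_; ↭⇒↭ₛ)
open import Data.List.Relation.Binary.Permutation.Propositional.Properties using (++-comm)
import Data.List.Relation.Binary.Permutation.Setoid as ↭ₛ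
import Data.List.Relation.Binary.Permutation.Setoid.Properties as ↭ₛ
open import Data.List.Relation.Binary.Pointwise as Pointwise using (Pointwise; []; _∷_)
import Data.List.Relation.Binary.Pointwise.Properties as Pointwise
open import Data.Nat as ℕ using (ℕ; zero; suc; _+_; _%_; _≤_; z≤n; s≤s)
import Data.Nat.Properties as ℕ
open import Data.Nat.DivMod using (_mod_; m%n<n; %-distribˡ-+)
open import Data.Product using (Σ; ∃; ∃-syntax; _×_; _,_; proj₁; proj₂; swap)
open import Data.Sum using (_⊎_; inj₁; inj₂; [_,_]′)
open import Data.Vec as Vec using (Vec; []; _∷_; lookup; tabulate)
import Data.Vec.Properties as Vec
open import Function using (_∘_; case_of_)
open import Level using (0ℓ)
open import Relation.Binary.Definitions using (DecidableEquality)
open import Relation.Binary.PropositionalEquality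
open import Relation.Nullary using (Dec; yes; no; does; ¬?)
open import Relation.Nullary.Decidable using (dec-true; dec-false; from-yes; map′; _×-dec_; _→-dec_; _⊎-dec_)
open import Relation.Unary using (Pred; Decidable)

allBool? : ∀ {p} {P : Pred Bool p} → Decidable P → Dec (∀ b → P b)
allBool? P? = map′ (λ { (p , q) false → p ; (p , q) true → q }) (λ h → h false , h true) (P? false ×-dec P? true)

∀-vec? : ∀ {k m p} {P : Pred (Vec (Fin k) m) p} → Decidable P → Dec (∀ u → P u)
∀-vec? {m = zero} P? = map′ (λ { p [] → p }) (λ p → p []) (P? [])
∀-vec? {m = suc m} P? = map′ (λ { p (x ∷ u) → p x u }) (λ p x u → p (x ∷ u)) (all? λ x → ∀-vec? λ u → P? (x ∷ u))

-- ℤ₄ and finite sums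

Z4 : Set
Z4 = Fin 4

pattern z0 = zero
pattern z1 = suc zero
pattern z2 = suc (suc zero)
pattern z3 = suc (suc (suc zero))

infixl 6 _⊕_
infix 8 ⊖_

_⊕_ : Z4 → Z4 → Z4
z0 ⊕ b  = b
z1 ⊕ z0 = z1
z1 ⊕ z1 = z2
z1 ⊕ z2 = z3
z1 ⊕ z3 = z0
z2 ⊕ z0 = z2
z2 ⊕ z1 = z3
z2 ⊕ z2 = z0
z2 ⊕ z3 = z1
z3 ⊕ z0 = z3
z3 ⊕ z1 = z0
z3 ⊕ z2 = z1
z3 ⊕ z3 = z2

⊖_ : Z4 → Z4
⊖ z0 = z0
⊖ z1 = z3
⊖ z2 = z2
⊖ z3 = z1

⊕-assoc : ∀ a b c → (a ⊕ b) ⊕ c ≡ a ⊕ (b ⊕ c)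
⊕-assoc = from-yes (all? λ a → all? λ b → all? λ c → (a ⊕ b) ⊕ c ≟ a ⊕ (b ⊕ c))

⊕-comm : ∀ a b → a ⊕ b ≡ b ⊕ a
⊕-comm = from-yes (all? λ a → all? λ b → a ⊕ b ≟ b ⊕ a)

⊕-identityˡ : ∀ a → z0 ⊕ a ≡ a
⊕-identityˡ a = refl

⊕-identityʳ : ∀ a → a ⊕ z0 ≡ a
⊕-identityʳ = from-yes (all? λ a → a ⊕ z0 ≟ a)

⊖-inverseʳ : ∀ a → a ⊕ ⊖ a ≡ z0
⊖-inverseʳ = from-yes (all? λ a → a ⊕ ⊖ a ≟ z0)

⊖-involutive : ∀ a → ⊖ ⊖ a ≡ a
⊖-involutive = from-yes (all? λ a → ⊖ ⊖ a ≟ a)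

⊖-distrib-⊕ : ∀ a b → ⊖ (a ⊕ b) ≡ ⊖ a ⊕ ⊖ b
⊖-distrib-⊕ = from-yes (all? λ a → all? λ b → ⊖ (a ⊕ b) ≟ ⊖ a ⊕ ⊖ b)

⊕⊖≡z0⇒≡ : ∀ a b → a ⊕ ⊖ b ≡ z0 → a ≡ b
⊕⊖≡z0⇒≡ = from-yes (all? λ a → all? λ b → (a ⊕ ⊖ b ≟ z0) →-dec (a ≟ b))

⊖-injective : ∀ {a b} → ⊖ a ≡ ⊖ b → a ≡ b
⊖-injective {a} {b} e = trans (sym (⊖-involutive a)) (trans (cong ⊖_ e) (⊖-involutive b))

⊖-nonzero : ∀ a → a ≢ z0 → ⊖ a ≢ z0
⊖-nonzero = from-yes (all? λ a → ¬? (a ≟ z0) →-dec ¬? (⊖ a ≟ z0))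

-- in ℤ₄, a ≠ -a exactly when a is odd
odd : Z4 → Bool
odd a = not (does (a ≟ ⊖ a))

sgn : Bool → Z4 → Z4
sgn false a = a
sgn true a = ⊖ a

sgn-involutive : ∀ b a → sgn b (sgn b a) ≡ a
sgn-involutive false a = refl
sgn-involutive true a = ⊖-involutive a

sgn-injective : ∀ b {x y} → sgn b x ≡ sgn b y → x ≡ y
sgn-injective false e = e
sgn-injective true e = ⊖-injective e

sgn-nonzero : ∀ b a → a ≢ z0 → sgn b a ≢ z0
sgn-nonzero false a a≢0 = a≢0
sgn-nonzero true a = ⊖-nonzero a

sgn-⊖ : ∀ b a → sgn b (⊖ a) ≡ ⊖ sgn b a
sgn-⊖ false a = refl
sgn-⊖ true a = refl

odd-⊖ : ∀ a → odd (⊖ a) ≡ odd a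
odd-⊖ = from-yes (all? λ a → odd (⊖ a) Bool.≟ odd a)

odd-sgn : ∀ r a → odd (sgn r a) ≡ odd a
odd-sgn false a = refl
odd-sgn true a = odd-⊖ a

Z4-commutativeMonoid : CommutativeMonoid 0ℓ 0ℓ
Z4-commutativeMonoid = record
  { Carrier = Z4 ; _≈_ = _≡_ ; _∙_ = _⊕_ ; ε = z0
  ; isCommutativeMonoid = record
    { isMonoid = record
      { isSemigroup = record
        { isMagma = record { isEquivalence = isEquivalence ; ∙-cong = cong₂ _⊕_ }
        ; assoc = ⊕-assoc }
      ; identity = ⊕-identityˡ , ⊕-identityʳ }
    ; comm = ⊕-comm } }

module ΣZ = MonoidSum Z4-commutativeMonoid
module Σℕ = MonoidSum ℕ.+-0-commutativeMonoid

module _ {c ℓ} (M : CommutativeMonoid c ℓ) where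
  open CommutativeMonoid M
    using (Carrier; _≈_; ε; _∙_; ∙-congˡ; ∙-congʳ; identityˡ; identityʳ)
    renaming (refl to ≈-refl; trans to ≈-trans)
  open MonoidSum M using (sum)
  open import Algebra.Properties.CommutativeSemigroup (CommutativeMonoid.commutativeSemigroup M) using (interchange)

  interchange₃ : ∀ a₀ a₁ a₂ b₀ b₁ b₂ → (a₀ ∙ (a₁ ∙ a₂)) ∙ (b₀ ∙ (b₁ ∙ b₂)) ≈ (a₀ ∙ b₀) ∙ ((a₁ ∙ b₁) ∙ (a₂ ∙ b₂))
  interchange₃ a₀ a₁ a₂ b₀ b₁ b₂ = ≈-trans (interchange a₀ (a₁ ∙ a₂) b₀ (b₁ ∙ b₂)) (∙-congˡ (interchange a₁ a₂ b₁ b₂))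

  sum-zero : ∀ {m} (f : Fin m → Carrier) → (∀ i → f i ≈ ε) → sum f ≈ ε
  sum-zero {zero} f h = ≈-refl
  sum-zero {suc m} f h = ≈-trans (∙-congʳ (h zero)) (≈-trans (identityˡ _) (sum-zero (f ∘ suc) (h ∘ suc)))

  sum-single : ∀ {m} (f : Fin m → Carrier) i → (∀ j → j ≢ i → f j ≈ ε) → sum f ≈ f i
  sum-single f zero h = ≈-trans (∙-congˡ (sum-zero (f ∘ suc) λ j → h (suc j) λ ())) (identityʳ (f zero))
  sum-single f (suc i) h = ≈-trans (∙-congʳ (h zero λ ()))
    (≈-trans (identityˡ _) (sum-single (f ∘ suc) i λ j j≢i → h (suc j) (j≢i ∘ suc-injective)))

⊕-⊖-interchange₃ : ∀ p₀ p₁ p₂ q₀ q₁ q₂ →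
  (p₀ ⊕ (p₁ ⊕ p₂)) ⊕ ⊖ (q₀ ⊕ (q₁ ⊕ q₂)) ≡ (p₀ ⊕ ⊖ q₀) ⊕ ((p₁ ⊕ ⊖ q₁) ⊕ (p₂ ⊕ ⊖ q₂))
⊕-⊖-interchange₃ p₀ p₁ p₂ q₀ q₁ q₂ = begin
  (p₀ ⊕ (p₁ ⊕ p₂)) ⊕ ⊖ (q₀ ⊕ (q₁ ⊕ q₂))           ≡⟨ cong (λ z → (p₀ ⊕ (p₁ ⊕ p₂)) ⊕ z)
                                                       (trans (⊖-distrib-⊕ q₀ _) (cong (⊖ q₀ ⊕_) (⊖-distrib-⊕ q₁ q₂))) ⟩
  (p₀ ⊕ (p₁ ⊕ p₂)) ⊕ (⊖ q₀ ⊕ (⊖ q₁ ⊕ ⊖ q₂))        ≡⟨ interchange₃ Z4-commutativeMonoid p₀ p₁ p₂ (⊖ q₀) (⊖ q₁) (⊖ q₂) ⟩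
  (p₀ ⊕ ⊖ q₀) ⊕ ((p₁ ⊕ ⊖ q₁) ⊕ (p₂ ⊕ ⊖ q₂))       ∎
  where open ≡-Reasoning

ΣZ-⊖ : ∀ {m} (f : Fin m → Z4) → ΣZ.sum (⊖_ ∘ f) ≡ ⊖ ΣZ.sum f
ΣZ-⊖ {zero} f = refl
ΣZ-⊖ {suc m} f = trans (cong (⊖ f zero ⊕_) (ΣZ-⊖ (f ∘ suc))) (sym (⊖-distrib-⊕ (f zero) _))

Σℕ≡1⇒single : ∀ {m} (f : Fin m → ℕ) → Σℕ.sum f ≡ 1 → Σ (Fin m) λ i → f i ≡ 1 × (∀ j → j ≢ i → f j ≡ 0)
Σℕ≡1⇒single {zero} f ()
Σℕ≡1⇒single {suc m} f sum≡1 with f zero in eq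
... | zero with Σℕ≡1⇒single (f ∘ suc) sum≡1
...   | i , fi≡1 , rest = suc i , fi≡1 , λ { zero _ → eq ; (suc j) j≢i → rest j (j≢i ∘ cong suc) }
Σℕ≡1⇒single {suc m} f sum≡1 | suc zero =
  zero , eq , λ { zero 0≢0 → ⊥-elim (0≢0 refl) ; (suc j) _ → sum≡0 (f ∘ suc) (ℕ.suc-injective sum≡1) j }
  where
  sum≡0 : ∀ {k} (g : Fin k → ℕ) → Σℕ.sum g ≡ 0 → ∀ j → g j ≡ 0
  sum≡0 g s zero = ℕ.m+n≡0⇒m≡0 (g zero) s
  sum≡0 g s (suc j) = sum≡0 (g ∘ suc) (ℕ.m+n≡0⇒n≡0 (g zero) s) j
Σℕ≡1⇒single {suc m} f sum≡1 | suc (suc k) with () ← ℕ.suc-injective sum≡1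

Σℕ-mono-≤ : ∀ {m} (f g : Fin m → ℕ) → (∀ i → f i ≤ g i) → Σℕ.sum f ≤ Σℕ.sum g
Σℕ-mono-≤ {zero} f g h = z≤n
Σℕ-mono-≤ {suc m} f g h = ℕ.+-mono-≤ (h zero) (Σℕ-mono-≤ (f ∘ suc) (g ∘ suc) (h ∘ suc))

toZ : ℕ → Z4
toZ m = m mod 4

toℕ-toZ : ∀ a → toℕ (toZ a) ≡ a % 4
toℕ-toZ a = toℕ-fromℕ< (m%n<n a 4)

toℕ-⊕ : ∀ a b → toℕ (a ⊕ b) ≡ (toℕ a + toℕ b) % 4
toℕ-⊕ = from-yes (all? λ a → all? λ b → toℕ (a ⊕ b) ℕ.≟ (toℕ a + toℕ b) % 4)

toZ-+ : ∀ a b → toZ (a + b) ≡ toZ a ⊕ toZ b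
toZ-+ a b = toℕ-injective (begin
  toℕ (toZ (a + b))                    ≡⟨ toℕ-toZ (a + b) ⟩
  (a + b) % 4                          ≡⟨ %-distribˡ-+ a b 4 ⟩
  (a % 4 + b % 4) % 4                  ≡⟨ cong₂ (λ p q → (p + q) % 4) (toℕ-toZ a) (toℕ-toZ b) ⟨
  (toℕ (toZ a) + toℕ (toZ b)) % 4      ≡⟨ toℕ-⊕ (toZ a) (toZ b) ⟨
  toℕ (toZ a ⊕ toZ b)                  ∎)
  where open ≡-Reasoning

toZ-toℕ : ∀ a → toZ (toℕ a) ≡ a
toZ-toℕ = from-yes (all? λ a → toZ (toℕ a) ≟ a)

toZ≡⇒%≡ : ∀ a b → toZ a ≡ toZ b → a % 4 ≡ b % 4
toZ≡⇒%≡ a b e = trans (sym (toℕ-toZ a)) (trans (cong toℕ e) (toℕ-toZ b))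

%≡⇒toZ≡ : ∀ a b → a % 4 ≡ b % 4 → toZ a ≡ toZ b
%≡⇒toZ≡ a b e = toℕ-injective (trans (toℕ-toZ a) (trans e (sym (toℕ-toZ b))))

toZ-Σℕ : ∀ {m} (f : Fin m → ℕ) → toZ (Σℕ.sum f) ≡ ΣZ.sum (toZ ∘ f)
toZ-Σℕ {zero} f = refl
toZ-Σℕ {suc m} f = trans (toZ-+ (f zero) _) (cong (toZ (f zero) ⊕_) (toZ-Σℕ (f ∘ suc)))

sumN-tabulate : ∀ {n} {es : Edges n} {k} (f : Fin k → ℕ) → sumN es (tabulate f) ≡ Σℕ.sum f
sumN-tabulate {k = zero} f = refl
sumN-tabulate {es = es} {suc k} f = cong (f zero +_) (sumN-tabulate {es = es} (f ∘ suc))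

vec-ext : ∀ {A : Set} {k} {u w : Vec A k} → (∀ i → lookup u i ≡ lookup w i) → u ≡ w
vec-ext {u = u} {w} h = trans (sym (Vec.tabulate∘lookup u)) (trans (Vec.tabulate-cong h) (Vec.tabulate∘lookup w))


-- Flows, degrees and cycles of an edge list

ZeroOrTwo : ℕ → Set
ZeroOrTwo d = d ≡ 0 ⊎ d ≡ 2

zeroOrTwo? : ∀ d → Dec (ZeroOrTwo d)
zeroOrTwo? d = (d ℕ.≟ 0) ⊎-dec (d ℕ.≟ 2)

𝟙 : Bool → ℕ
𝟙 b = if b then 1 else 0

sel : Bool → Z4 → Z4
sel b a = if b then a else z0

sel-⊖ : ∀ b a → sel b (⊖ a) ≡ ⊖ sel b a
sel-⊖ true a = refl
sel-⊖ false a = refl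

module _ {n} (es : Edges n) where

  ends : Fin (length es) → Fin n → ℕ
  ends i x = 𝟙 (does (tl es i ≟ x)) + 𝟙 (does (hd es i ≟ x))

  deg : Fin n → ℕ
  deg x = Σℕ.sum λ i → ends i x

  degS : EdgeSet es → Fin n → ℕ
  degS S x = Σℕ.sum λ i → if lookup S i then ends i x else 0

  degIn≡degS : ∀ S x → degIn es S x ≡ degS S x
  degIn≡degS S x = sumN-tabulate {es = es} λ i → if lookup S i then ends i x else 0

  degS≤deg : ∀ S x → degS S x ≤ deg x
  degS≤deg S x = Σℕ-mono-≤ _ _ λ i → if≤ (lookup S i) (ends i x)
    where
    if≤ : ∀ b e → (if b then e else 0) ≤ e
    if≤ true e = ℕ.≤-refl
    if≤ false e = z≤n

  contrib : Z4Map es → Fin (length es) → Fin n → Z4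
  contrib f i x = sel (does (tl es i ≟ x)) (lookup f i) ⊕ ⊖ sel (does (hd es i ≟ x)) (lookup f i)

  net : Z4Map es → Fin n → Z4
  net f x = ΣZ.sum λ i → contrib f i x

  private
    toZ-if : ∀ b a → toZ (if b then toℕ a else 0) ≡ sel b a
    toZ-if true a = toZ-toℕ a
    toZ-if false a = refl

    toZ-outSum : ∀ f x → toZ (outSum es f x) ≡ ΣZ.sum λ i → sel (does (tl es i ≟ x)) (lookup f i)
    toZ-outSum f x = trans (cong toZ (sumN-tabulate {es = es} h))
      (trans (toZ-Σℕ h) (ΣZ.sum-cong-≗ λ i → toZ-if (does (tl es i ≟ x)) (lookup f i)))
      where h = λ i → if does (tl es i ≟ x) then toℕ (lookup f i) else 0

    toZ-inSum : ∀ f x → toZ (inSum es f x) ≡ ΣZ.sum λ i → sel (does (hd es i ≟ x)) (lookup f i)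
    toZ-inSum f x = trans (cong toZ (sumN-tabulate {es = es} h))
      (trans (toZ-Σℕ h) (ΣZ.sum-cong-≗ λ i → toZ-if (does (hd es i ≟ x)) (lookup f i)))
      where h = λ i → if does (hd es i ≟ x) then toℕ (lookup f i) else 0

    net≡out⊖in : ∀ f x → net f x ≡ toZ (outSum es f x) ⊕ ⊖ toZ (inSum es f x)
    net≡out⊖in f x = trans (ΣZ.∑-distrib-+ (λ i → sel (does (tl es i ≟ x)) (lookup f i))
                                           (λ i → ⊖ sel (does (hd es i ≟ x)) (lookup f i)))
      (cong₂ _⊕_ (sym (toZ-outSum f x)) (trans (ΣZ-⊖ (λ i → sel (does (hd es i ≟ x)) (lookup f i))) (cong ⊖_ (sym (toZ-inSum f x)))))

  flow⇒net≡0 : ∀ f → IsZ4Flow es f → ∀ x → net f x ≡ z0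
  flow⇒net≡0 f flow x = trans (net≡out⊖in f x)
    (trans (cong (_⊕ ⊖ toZ (inSum es f x)) (%≡⇒toZ≡ (outSum es f x) (inSum es f x) (flow x)))
           (⊖-inverseʳ (toZ (inSum es f x))))

  net≡0⇒flow : ∀ f → (∀ x → net f x ≡ z0) → IsZ4Flow es f
  net≡0⇒flow f balanced x = toZ≡⇒%≡ (outSum es f x) (inSum es f x)
    (⊕⊖≡z0⇒≡ (toZ (outSum es f x)) (toZ (inSum es f x)) (trans (sym (net≡out⊖in f x)) (balanced x)))

  neg : Z4Map es → Z4Map es
  neg = Vec.map ⊖_

  lookup-neg : ∀ f i → lookup (neg f) i ≡ ⊖ lookup f i
  lookup-neg f i = Vec.lookup-map i ⊖_ f

  contrib-neg : ∀ f i x → contrib (neg f) i x ≡ ⊖ contrib f i x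
  contrib-neg f i x rewrite lookup-neg f i
    | sel-⊖ (does (tl es i ≟ x)) (lookup f i) | sel-⊖ (does (hd es i ≟ x)) (lookup f i) =
    sym (⊖-distrib-⊕ (sel (does (tl es i ≟ x)) (lookup f i)) (⊖ sel (does (hd es i ≟ x)) (lookup f i)))

  neg-nzFlow : ∀ f → NZFlow es f → NZFlow es (neg f)
  neg-nzFlow f (flow , nz) =
    net≡0⇒flow (neg f) (λ x → trans (ΣZ.sum-cong-≗ λ i → contrib-neg f i x)
                                 (trans (ΣZ-⊖ (λ i → contrib f i x)) (cong ⊖_ (flow⇒net≡0 f flow x)))) ,
    λ i fi≡0 → ⊖-nonzero _ (nz i) (trans (sym (lookup-neg f i)) fi≡0)

  Reach-trans : ∀ {S x y z} → Reach es S x y → Reach es S y z → Reach es S x z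
  Reach-trans here q = q
  Reach-trans (fwd i s p) q = fwd i s (Reach-trans p q)
  Reach-trans (bwd i s p) q = bwd i s (Reach-trans p q)

  Reach-sym : ∀ {S x y} → Reach es S x y → Reach es S y x
  Reach-sym here = here
  Reach-sym (fwd i s p) = Reach-trans (Reach-sym p) (bwd i s here)
  Reach-sym (bwd i s p) = Reach-trans (Reach-sym p) (fwd i s here)

  lookup-diffSupport : ∀ f g i → lookup (diffSupport es f g) i ≡ not (does (lookup f i ≟ lookup g i))
  lookup-diffSupport f g i = Vec.lookup∘tabulate (λ j → not (does (lookup f j ≟ lookup g j))) i

  diffSupport-self : ∀ f i → lookup (diffSupport es f f) i ≡ false
  diffSupport-self f i = trans (lookup-diffSupport f f i) (cong not (dec-true (lookup f i ≟ lookup f i) refl))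

  diffSupport-nonempty : ∀ f g → f ≢ g → ∃[ i ] InS es (diffSupport es f g) i
  diffSupport-nonempty f g f≢g with all? (λ i → lookup f i ≟ lookup g i)
  ... | yes same = ⊥-elim (f≢g (vec-ext same))
  ... | no differ with ¬∀⟶∃¬ _ _ (λ i → lookup f i ≟ lookup g i) differ
  ...   | i , fi≢gi = i , trans (lookup-diffSupport f g i) (cong not (dec-false (lookup f i ≟ lookup g i) fi≢gi))

  Connected : EdgeSet es → Set
  Connected S = ∀ i j → InS es S i → InS es S j → Reach es S (tl es i) (tl es j)

  Reach-from : ∀ {S} r → (∀ x → Reach es S r x) → ∀ x y → Reach es S x y
  Reach-from r spans x y = Reach-trans (Reach-sym (spans x)) (spans y)

  oddSupport : Z4Map es → EdgeSet es
  oddSupport f = diffSupport es f (neg f)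

  lookup-oddSupport : ∀ f i → lookup (oddSupport f) i ≡ odd (lookup f i)
  lookup-oddSupport f i = trans (lookup-diffSupport f (neg f) i)
    (cong (λ b → not (does (lookup f i ≟ b))) (lookup-neg f i))

  -- Doubling Kirchhoff's law at x kills the even values: twice the number of odd arc-ends
  -- at x is 0 in ℤ₄.
  oddSupport-degree : (∀ x → deg x ≡ 3) → ∀ f → IsZ4Flow es f →
                      ∀ x → ZeroOrTwo (degIn es (oddSupport f) x)
  oddSupport-degree cubic f flow x rewrite degIn≡degS (oddSupport f) x =
    even≤3 (degS S x) (subst (degS S x ≤_) (cubic x) (degS≤deg S x)) twice≡0
    where
    S = oddSupport f
    D = degS S x
    e : Fin (length es) → ℕ
    e i = if lookup S i then ends i x else 0

    twice-contrib : ∀ bt bh a →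
      toZ (if odd a then 𝟙 bt + 𝟙 bh else 0) ⊕ toZ (if odd a then 𝟙 bt + 𝟙 bh else 0)
        ≡ (sel bt a ⊕ ⊖ sel bh a) ⊕ (sel bt a ⊕ ⊖ sel bh a)
    twice-contrib = from-yes (allBool? λ bt → allBool? λ bh → all? λ a →
      toZ (if odd a then 𝟙 bt + 𝟙 bh else 0) ⊕ toZ (if odd a then 𝟙 bt + 𝟙 bh else 0)
        ≟ (sel bt a ⊕ ⊖ sel bh a) ⊕ (sel bt a ⊕ ⊖ sel bh a))

    twice≡0 : toZ (D + D) ≡ z0
    twice≡0 = begin
      toZ (D + D)                                  ≡⟨ toZ-+ D D ⟩
      toZ D ⊕ toZ D                                ≡⟨ cong (λ z → z ⊕ z) (toZ-Σℕ e) ⟩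
      ΣZ.sum (toZ ∘ e) ⊕ ΣZ.sum (toZ ∘ e)          ≡⟨ ΣZ.∑-distrib-+ (toZ ∘ e) (toZ ∘ e) ⟨
      ΣZ.sum (λ i → toZ (e i) ⊕ toZ (e i))         ≡⟨ ΣZ.sum-cong-≗ (λ i →
        trans (cong (λ b → toZ (if b then ends i x else 0) ⊕ toZ (if b then ends i x else 0))
                    (lookup-oddSupport f i))
              (twice-contrib (does (tl es i ≟ x)) (does (hd es i ≟ x)) (lookup f i))) ⟩
      ΣZ.sum (λ i → contrib f i x ⊕ contrib f i x) ≡⟨ ΣZ.∑-distrib-+ (λ i → contrib f i x) (λ i → contrib f i x) ⟩
      net f x ⊕ net f x                            ≡⟨ cong (λ z → z ⊕ z) (flow⇒net≡0 f flow x) ⟩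
      z0                                           ∎
      where open ≡-Reasoning

    even≤3 : ∀ d → d ≤ 3 → toZ (d + d) ≡ z0 → ZeroOrTwo d
    even≤3 0 _ _ = inj₁ refl
    even≤3 1 _ ()
    even≤3 2 _ _ = inj₂ refl
    even≤3 3 _ ()
    even≤3 (suc (suc (suc (suc _)))) (s≤s (s≤s (s≤s ()))) _

  isZ4Flow? : Decidable (IsZ4Flow es)
  isZ4Flow? f = all? λ x → outSum es f x % 4 ℕ.≟ inSum es f x % 4

  nzFlow? : Decidable (NZFlow es)
  nzFlow? f = isZ4Flow? f ×-dec all? λ i → ¬? (lookup f i ≟ z0)

record KleeInvariant {n} (es : Edges n) : Set where
  field
    cubic : ∀ x → deg es x ≡ 3
    sixFlows : FlowGraphHasVertices es 6
    adjacent⇒neg : ∀ f g → NZFlow es f → NZFlow es g → FlowAdj es f g → g ≡ neg es f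
    adjacent-neg : ∀ f → NZFlow es f → FlowAdj es f (neg es f)

  oneRegular : FlowGraphOneRegular es
  oneRegular f nzf = neg es f , neg-nzFlow es f nzf , adjacent-neg f nzf ,
    λ g nzg f~g → adjacent⇒neg f g nzf nzg f~g

-- Transport along isomorphisms

orient : ∀ {A : Set} → Bool → A × A → A × A
orient false p = p
orient true p = swap p

both : ∀ {A B : Set} → (A → B) → A × A → B × B
both φ (a , b) = φ a , φ b

orient-involutive : ∀ {A : Set} b (p : A × A) → orient b (orient b p) ≡ p
orient-involutive false p = refl
orient-involutive true (a , b) = refl

both-orient : ∀ {A B : Set} (φ : A → B) b (p : A × A) → both φ (orient b p) ≡ orient b (both φ p)
both-orient φ false p = refl
both-orient φ true (a , b) = refl

does-injective : ∀ {k l} (g : Fin k → Fin l) → (∀ {a b} → g a ≡ g b → a ≡ b) →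
                 ∀ a b → does (g a ≟ g b) ≡ does (a ≟ b)
does-injective g g-inj a b with a ≟ b
... | yes refl = dec-true (g a ≟ g a) refl
... | no a≢b = dec-false (g a ≟ g b) (a≢b ∘ g-inj)

record Iso {n n′} (es : Edges n) (es′ : Edges n′) : Set where
  field
    φ : Permutation n n′
    σ : Permutation (length es) (length es′)
    reversed : Fin (length es) → Bool
    arc-σ : ∀ i → Arc es′ (σ ⟨$⟩ʳ i) ≡ orient (reversed i) (both (φ ⟨$⟩ʳ_) (Arc es i))

Iso-sym : ∀ {n n′} {es : Edges n} {es′ : Edges n′} → Iso es es′ → Iso es′ es
Iso-sym {es = es} {es′} ι = record
  { φ = Perm.flip φ ; σ = Perm.flip σ ; reversed = reversed ∘ (σ ⟨$⟩ˡ_) ; arc-σ = arc-σ⁻ }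
  where
  open Iso ι
  open ≡-Reasoning
  arc-σ⁻ : ∀ j → Arc es (σ ⟨$⟩ˡ j) ≡ orient (reversed (σ ⟨$⟩ˡ j)) (both (φ ⟨$⟩ˡ_) (Arc es′ j))
  arc-σ⁻ j = sym (begin
      orient b (both (φ ⟨$⟩ˡ_) (Arc es′ j))
        ≡⟨ cong (λ k → orient b (both (φ ⟨$⟩ˡ_) (Arc es′ k))) (Perm.inverseʳ σ) ⟨
      orient b (both (φ ⟨$⟩ˡ_) (Arc es′ (σ ⟨$⟩ʳ (σ ⟨$⟩ˡ j))))
        ≡⟨ cong (orient b ∘ both (φ ⟨$⟩ˡ_)) (arc-σ (σ ⟨$⟩ˡ j)) ⟩
      orient b (both (φ ⟨$⟩ˡ_) (orient b (both (φ ⟨$⟩ʳ_) p)))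
        ≡⟨ cong (orient b) (both-orient (φ ⟨$⟩ˡ_) b _) ⟩
      orient b (orient b (both (φ ⟨$⟩ˡ_) (both (φ ⟨$⟩ʳ_) p)))
        ≡⟨ orient-involutive b _ ⟩
      both (φ ⟨$⟩ˡ_) (both (φ ⟨$⟩ʳ_) p)
        ≡⟨ cong₂ _,_ (Perm.inverseˡ φ) (Perm.inverseˡ φ) ⟩
      p ∎)
    where
    b = reversed (σ ⟨$⟩ˡ j)
    p = Arc es (σ ⟨$⟩ˡ j)

module Transport {n n′} {es : Edges n} {es′ : Edges n′} (ι : Iso es es′) where
  open Iso ι

  φ⁺ : Fin n → Fin n′
  φ⁺ = φ ⟨$⟩ʳ_
  φ⁻ : Fin n′ → Fin n
  φ⁻ = φ ⟨$⟩ˡ_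
  σ⁺ : Fin (length es) → Fin (length es′)
  σ⁺ = σ ⟨$⟩ʳ_
  σ⁻ : Fin (length es′) → Fin (length es)
  σ⁻ = σ ⟨$⟩ˡ_

  φ⁺-injective : ∀ {a b} → φ⁺ a ≡ φ⁺ b → a ≡ b
  φ⁺-injective {a} {b} e = trans (sym (Perm.inverseˡ φ)) (trans (cong φ⁻ e) (Perm.inverseˡ φ))

  tlʳ hdʳ : Bool → Fin (length es) → Fin n
  tlʳ r i = if r then hd es i else tl es i
  hdʳ r i = if r then tl es i else hd es i

  tl-σ : ∀ i → tl es′ (σ⁺ i) ≡ φ⁺ (tlʳ (reversed i) i)
  tl-σ i with reversed i | arc-σ i
  ... | false | e = cong proj₁ e
  ... | true | e = cong proj₁ e

  hd-σ : ∀ i → hd es′ (σ⁺ i) ≡ φ⁺ (hdʳ (reversed i) i)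
  hd-σ i with reversed i | arc-σ i
  ... | false | e = cong proj₂ e
  ... | true | e = cong proj₂ e

  does-φ : ∀ a x → does (φ⁺ a ≟ φ⁺ x) ≡ does (a ≟ x)
  does-φ = does-injective φ⁺ φ⁺-injective

  ends-σ : ∀ i x → ends es′ (σ⁺ i) (φ⁺ x) ≡ ends es i x
  ends-σ i x rewrite tl-σ i | hd-σ i | does-φ (tlʳ (reversed i) i) x | does-φ (hdʳ (reversed i) i) x =
    lemma (reversed i)
    where
    lemma : ∀ r → 𝟙 (does (tlʳ r i ≟ x)) + 𝟙 (does (hdʳ r i ≟ x)) ≡ ends es i x
    lemma false = refl
    lemma true = ℕ.+-comm (𝟙 (does (hd es i ≟ x))) (𝟙 (does (tl es i ≟ x)))

  T : Z4Map es → Z4Map es′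
  T f = tabulate λ j → sgn (reversed (σ⁻ j)) (lookup f (σ⁻ j))

  lookup-T : ∀ f j → lookup (T f) j ≡ sgn (reversed (σ⁻ j)) (lookup f (σ⁻ j))
  lookup-T f j = Vec.lookup∘tabulate _ j

  lookup-T-σ : ∀ f i → lookup (T f) (σ⁺ i) ≡ sgn (reversed i) (lookup f i)
  lookup-T-σ f i rewrite lookup-T f (σ⁺ i) | Perm.inverseˡ σ {i} = refl

  contrib-σ : ∀ f i x → contrib es′ (T f) (σ⁺ i) (φ⁺ x) ≡ contrib es f i x
  contrib-σ f i x rewrite lookup-T-σ f i | tl-σ i | hd-σ i
    | does-φ (tlʳ (reversed i) i) x | does-φ (hdʳ (reversed i) i) x = lemma (reversed i) (lookup f i)
    where
    lemma : ∀ r a → sel (does (tlʳ r i ≟ x)) (sgn r a) ⊕ ⊖ sel (does (hdʳ r i ≟ x)) (sgn r a)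
                  ≡ sel (does (tl es i ≟ x)) a ⊕ ⊖ sel (does (hd es i ≟ x)) a
    lemma false a = refl
    lemma true a rewrite sel-⊖ (does (hd es i ≟ x)) a | sel-⊖ (does (tl es i ≟ x)) a
      | ⊖-involutive (sel (does (tl es i ≟ x)) a) = ⊕-comm (⊖ sel (does (hd es i ≟ x)) a) (sel (does (tl es i ≟ x)) a)

  net-T : ∀ f x → net es′ (T f) (φ⁺ x) ≡ net es f x
  net-T f x = trans (ΣZ.∑-permute (λ j → contrib es′ (T f) j (φ⁺ x)) σ)
                    (ΣZ.sum-cong-≗ λ i → contrib-σ f i x)

  nzFlow-T : ∀ f → NZFlow es f → NZFlow es′ (T f)
  nzFlow-T f (flow , nz) =
    net≡0⇒flow es′ (T f) (λ y → subst (λ z → net es′ (T f) z ≡ z0) (Perm.inverseʳ φ)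
                                 (trans (net-T f (φ⁻ y)) (flow⇒net≡0 es f flow (φ⁻ y)))) ,
    λ j e → sgn-nonzero (reversed (σ⁻ j)) _ (nz (σ⁻ j)) (trans (sym (lookup-T f j)) e)

  neg-T : ∀ f → T (neg es f) ≡ neg es′ (T f)
  neg-T f = vec-ext λ j → begin
      lookup (T (neg es f)) j                          ≡⟨ lookup-T (neg es f) j ⟩
      sgn (reversed (σ⁻ j)) (lookup (neg es f) (σ⁻ j)) ≡⟨ cong (sgn (reversed (σ⁻ j))) (lookup-neg es f (σ⁻ j)) ⟩
      sgn (reversed (σ⁻ j)) (⊖ lookup f (σ⁻ j))        ≡⟨ sgn-⊖ (reversed (σ⁻ j)) _ ⟩
      ⊖ sgn (reversed (σ⁻ j)) (lookup f (σ⁻ j))        ≡⟨ cong ⊖_ (lookup-T f j) ⟨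
      ⊖ lookup (T f) j                                 ≡⟨ lookup-neg es′ (T f) j ⟨
      lookup (neg es′ (T f)) j                         ∎
    where open ≡-Reasoning

  TS : EdgeSet es → EdgeSet es′
  TS S = tabulate λ j → lookup S (σ⁻ j)

  lookup-TS : ∀ S j → lookup (TS S) j ≡ lookup S (σ⁻ j)
  lookup-TS S j = Vec.lookup∘tabulate _ j

  lookup-TS-σ : ∀ S i → lookup (TS S) (σ⁺ i) ≡ lookup S i
  lookup-TS-σ S i rewrite lookup-TS S (σ⁺ i) | Perm.inverseˡ σ {i} = refl

  diffSupport-T : ∀ f g → diffSupport es′ (T f) (T g) ≡ TS (diffSupport es f g)
  diffSupport-T f g = vec-ext at
    where
    open ≡-Reasoning
    at : ∀ j → lookup (diffSupport es′ (T f) (T g)) j ≡ lookup (TS (diffSupport es f g)) j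
    at j = begin
      lookup (diffSupport es′ (T f) (T g)) j
        ≡⟨ Vec.lookup∘tabulate _ j ⟩
      not (does (lookup (T f) j ≟ lookup (T g) j))
        ≡⟨ cong₂ (λ u w → not (does (u ≟ w))) (lookup-T f j) (lookup-T g j) ⟩
      not (does (sgn r (lookup f (σ⁻ j)) ≟ sgn r (lookup g (σ⁻ j))))
        ≡⟨ cong not (does-injective (sgn r) (sgn-injective r) _ _) ⟩
      not (does (lookup f (σ⁻ j) ≟ lookup g (σ⁻ j)))
        ≡⟨ Vec.lookup∘tabulate _ (σ⁻ j) ⟨
      lookup (diffSupport es f g) (σ⁻ j)
        ≡⟨ lookup-TS (diffSupport es f g) j ⟨
      lookup (TS (diffSupport es f g)) j ∎
      where r = reversed (σ⁻ j)

  degS-TS : ∀ S x → degS es′ (TS S) (φ⁺ x) ≡ degS es S x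
  degS-TS S x = trans (Σℕ.∑-permute (λ j → if lookup (TS S) j then ends es′ j (φ⁺ x) else 0) σ)
    (Σℕ.sum-cong-≗ λ i → cong₂ (λ b e → if b then e else 0) (lookup-TS-σ S i) (ends-σ i x))

  arc-Reach : ∀ S i → InS es S i → Reach es′ (TS S) (φ⁺ (tl es i)) (φ⁺ (hd es i))
  arc-Reach S i i∈S = go (reversed i) (tl-σ i) (hd-σ i)
    where
    σi∈TS : InS es′ (TS S) (σ⁺ i)
    σi∈TS = trans (lookup-TS-σ S i) i∈S
    go : ∀ r → tl es′ (σ⁺ i) ≡ φ⁺ (tlʳ r i) → hd es′ (σ⁺ i) ≡ φ⁺ (hdʳ r i) →
         Reach es′ (TS S) (φ⁺ (tl es i)) (φ⁺ (hd es i))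
    go false e₁ e₂ = subst₂ (Reach es′ (TS S)) e₁ e₂ (fwd (σ⁺ i) σi∈TS here)
    go true e₁ e₂ = subst₂ (Reach es′ (TS S)) e₂ e₁ (bwd (σ⁺ i) σi∈TS here)

  Reach-TS : ∀ S {x y} → Reach es S x y → Reach es′ (TS S) (φ⁺ x) (φ⁺ y)
  Reach-TS S here = here
  Reach-TS S (fwd i i∈S p) = Reach-trans es′ (arc-Reach S i i∈S) (Reach-TS S p)
  Reach-TS S (bwd i i∈S p) = Reach-trans es′ (Reach-sym es′ (arc-Reach S i i∈S)) (Reach-TS S p)

  tl-σ-Reach : ∀ S i → InS es S i → Reach es′ (TS S) (tl es′ (σ⁺ i)) (φ⁺ (tl es i))
  tl-σ-Reach S i i∈S with reversed i | tl-σ i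
  ... | false | e = subst (λ z → Reach es′ (TS S) z (φ⁺ (tl es i))) (sym e) here
  ... | true | e = subst (λ z → Reach es′ (TS S) z (φ⁺ (tl es i))) (sym e) (Reach-sym es′ (arc-Reach S i i∈S))

  cycle-TS : ∀ S → IsCycleEdgeSet es S → IsCycleEdgeSet es′ (TS S)
  cycle-TS S ((i , i∈S) , degrees , connected) = (σ⁺ i , trans (lookup-TS-σ S i) i∈S) , degrees′ , connected′
    where
    degrees′ : ∀ y → degIn es′ (TS S) y ≡ 0 ⊎ degIn es′ (TS S) y ≡ 2
    degrees′ y rewrite degIn≡degS es′ (TS S) y | sym (Perm.inverseʳ φ {y}) | degS-TS S (φ⁻ y)
      | sym (degIn≡degS es S (φ⁻ y)) = degrees (φ⁻ y)
    connected-σ : ∀ i j → InS es S i → InS es S j → Reach es′ (TS S) (tl es′ (σ⁺ i)) (tl es′ (σ⁺ j))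
    connected-σ i j i∈S j∈S = Reach-trans es′ (tl-σ-Reach S i i∈S)
      (Reach-trans es′ (Reach-TS S (connected i j i∈S j∈S)) (Reach-sym es′ (tl-σ-Reach S j j∈S)))
    connected′ : ∀ j₁ j₂ → InS es′ (TS S) j₁ → InS es′ (TS S) j₂ → Reach es′ (TS S) (tl es′ j₁) (tl es′ j₂)
    connected′ j₁ j₂ j₁∈ j₂∈ = subst₂ (λ u w → Reach es′ (TS S) (tl es′ u) (tl es′ w)) (Perm.inverseʳ σ) (Perm.inverseʳ σ)
      (connected-σ (σ⁻ j₁) (σ⁻ j₂) (trans (sym (lookup-TS S j₁)) j₁∈) (trans (sym (lookup-TS S j₂)) j₂∈))

module _ {n n′} {es : Edges n} {es′ : Edges n′} (ι : Iso es es′) where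
  private
    module F = Transport ι
    module B = Transport (Iso-sym ι)
  open Iso ι

  T-inverseˡ : ∀ f → B.T (F.T f) ≡ f
  T-inverseˡ f = vec-ext λ i → begin
      lookup (B.T (F.T f)) i                                 ≡⟨ B.lookup-T (F.T f) i ⟩
      sgn (reversed (σ ⟨$⟩ˡ (σ ⟨$⟩ʳ i))) (lookup (F.T f) (σ ⟨$⟩ʳ i))
        ≡⟨ cong₂ sgn (cong reversed (Perm.inverseˡ σ)) (F.lookup-T-σ f i) ⟩
      sgn (reversed i) (sgn (reversed i) (lookup f i))       ≡⟨ sgn-involutive (reversed i) _ ⟩
      lookup f i                                             ∎
    where open ≡-Reasoning

  T-inverseʳ : ∀ g → F.T (B.T g) ≡ g
  T-inverseʳ g = vec-ext λ j → begin
      lookup (F.T (B.T g)) j                                       ≡⟨ F.lookup-T (B.T g) j ⟩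
      sgn (reversed (σ ⟨$⟩ˡ j)) (lookup (B.T g) (σ ⟨$⟩ˡ j))         ≡⟨ cong (sgn (reversed (σ ⟨$⟩ˡ j))) (B.lookup-T-σ g j) ⟩
      sgn (reversed (σ ⟨$⟩ˡ j)) (sgn (reversed (σ ⟨$⟩ˡ j)) (lookup g j)) ≡⟨ sgn-involutive (reversed (σ ⟨$⟩ˡ j)) _ ⟩
      lookup g j                                                   ∎
    where open ≡-Reasoning

  T-injective : ∀ f g → F.T f ≡ F.T g → f ≡ g
  T-injective f g e = trans (sym (T-inverseˡ f)) (trans (cong B.T e) (T-inverseˡ g))

  Iso-invariant : KleeInvariant es → KleeInvariant es′
  Iso-invariant I = record
    { cubic = cubic′ ; sixFlows = sixFlows′ ; adjacent⇒neg = adjacent⇒neg′ ; adjacent-neg = adjacent-neg′ }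
    where
    module I = KleeInvariant I
    cubic′ : ∀ y → deg es′ y ≡ 3
    cubic′ y rewrite sym (Perm.inverseʳ φ {y}) = trans (Σℕ.∑-permute (λ j → ends es′ j (F.φ⁺ (F.φ⁻ y))) σ)
      (trans (Σℕ.sum-cong-≗ λ i → F.ends-σ i (F.φ⁻ y)) (I.cubic (F.φ⁻ y)))
    sixFlows′ : FlowGraphHasVertices es′ 6
    sixFlows′ with I.sixFlows
    ... | L , distinct , nz , complete = Vec.map F.T L ,
      (λ a b e → distinct a b (T-injective _ _ (trans (sym (Vec.lookup-map a F.T L)) (trans e (Vec.lookup-map b F.T L))))) ,
      (λ a → subst (NZFlow es′) (sym (Vec.lookup-map a F.T L)) (F.nzFlow-T (lookup L a) (nz a))) ,
      λ g nzg → let (a , e) = complete (B.T g) (B.nzFlow-T g nzg) in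
        a , trans (Vec.lookup-map a F.T L) (trans (cong F.T e) (T-inverseʳ g))
    adjacent⇒neg′ : ∀ f g → NZFlow es′ f → NZFlow es′ g → FlowAdj es′ f g → g ≡ neg es′ f
    adjacent⇒neg′ f g nzf nzg f~g = begin
        g                      ≡⟨ T-inverseʳ g ⟨
        F.T (B.T g)            ≡⟨ cong F.T (I.adjacent⇒neg (B.T f) (B.T g) (B.nzFlow-T f nzf) (B.nzFlow-T g nzg)
                                     (subst (IsCycleEdgeSet es) (sym (B.diffSupport-T f g)) (B.cycle-TS _ f~g))) ⟩
        F.T (neg es (B.T f))   ≡⟨ F.neg-T (B.T f) ⟩
        neg es′ (F.T (B.T f))  ≡⟨ cong (neg es′) (T-inverseʳ f) ⟩
        neg es′ f              ∎
      where open ≡-Reasoning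
    adjacent-neg′ : ∀ g → NZFlow es′ g → FlowAdj es′ g (neg es′ g)
    adjacent-neg′ g nzg = subst (IsCycleEdgeSet es′) support-eq (F.cycle-TS _ (I.adjacent-neg f (B.nzFlow-T g nzg)))
      where
      f = B.T g
      support-eq : F.TS (diffSupport es f (neg es f)) ≡ diffSupport es′ g (neg es′ g)
      support-eq = trans (sym (F.diffSupport-T f (neg es f)))
        (cong₂ (diffSupport es′) (T-inverseʳ g) (trans (F.neg-T f) (cong (neg es′) (T-inverseʳ g))))

pointwiseIso : ∀ {n} {es es′ : Edges n} (φ : Permutation′ n) →
  Pointwise (λ e e′ → Σ Bool λ r → e′ ≡ orient r (both (φ ⟨$⟩ʳ_) e)) es es′ → Iso es es′
pointwiseIso φ pw = record
  { φ = φ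
  ; σ = Perm.cast-id (Pointwise.Pointwise-length pw)
  ; reversed = λ i → proj₁ (Pointwise.lookup-cast pw (Pointwise.Pointwise-length pw) i)
  ; arc-σ = λ i → proj₂ (Pointwise.lookup-cast pw (Pointwise.Pointwise-length pw) i) }

relabelIso : ∀ {n} (es : Edges n) (π : Permutation′ n) → Iso es (relabelEdges π es)
relabelIso es π = pointwiseIso π (relabelled es)
  where
  relabelled : ∀ es → Pointwise _ es (relabelEdges π es)
  relabelled [] = []
  relabelled (e ∷ es) = (false , refl) ∷ relabelled es

reorientIso : ∀ {n} {es es′ : Edges n} → Pointwise SameEdge es es′ → Iso es es′
reorientIso = pointwiseIso Perm.id ∘ Pointwise.map λ { (inj₁ e) → false , e ; (inj₂ e) → true , e }

reorderIso : ∀ {n} {es es′ : Edges n} → es ↭ es′ → Iso es es′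
reorderIso {n} p = record
  { φ = Perm.id
  ; σ = ↭ₛ.onIndices (↭⇒↭ₛ p)
  ; reversed = λ _ → false
  ; arc-σ = λ i → sym (↭ₛ.onIndices-lookup (setoid (Fin n × Fin n)) (↭⇒↭ₛ p) i) }

-- Flows around a triangle

Kirchhoff-solve : ∀ a c X → (a ⊕ ⊖ c) ⊕ X ≡ z0 → X ≡ c ⊕ ⊖ a
Kirchhoff-solve = from-yes (all? λ a → all? λ c → all? λ X → ((a ⊕ ⊖ c) ⊕ X ≟ z0) →-dec (X ≟ c ⊕ ⊖ a))

telescope : ∀ a b c → (c ⊕ ⊖ a) ⊕ ((a ⊕ ⊖ b) ⊕ (b ⊕ ⊖ c)) ≡ z0
telescope = from-yes (all? λ a → all? λ b → all? λ c → (c ⊕ ⊖ a) ⊕ ((a ⊕ ⊖ b) ⊕ (b ⊕ ⊖ c)) ≟ z0)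

-- Around a triangle with arcs V₀→V₁, V₁→V₂, V₂→V₀ carrying a, b, c, where the remaining
-- arc at Vₖ contributes Xₖ to the net outflow, Kirchhoff's law gives a = c - X₀ and
-- b = c - X₀ - X₁. So a, b, c ≠ 0 forces c to be the element of ℤ₄ other than 0, X₀ and
-- X₀ + X₁, which is 2 - (X₀ + (X₀ + X₁)) as the elements of ℤ₄ sum to 2.
triangleC : Z4 → Z4 → Z4
triangleC X₀ X₁ = z2 ⊕ ⊖ (X₀ ⊕ (X₀ ⊕ X₁))

triangleValue : Z4 → Z4 → Fin 3 → Z4
triangleValue X₀ X₁ 0F = triangleC X₀ X₁ ⊕ ⊖ X₀
triangleValue X₀ X₁ 1F = (triangleC X₀ X₁ ⊕ ⊖ X₀) ⊕ ⊖ X₁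
triangleValue X₀ X₁ 2F = triangleC X₀ X₁

triangle-unique : ∀ a b c → a ≢ z0 → b ≢ z0 → c ≢ z0 → c ⊕ ⊖ a ≢ z0 → a ⊕ ⊖ b ≢ z0 → b ⊕ ⊖ c ≢ z0 →
  let t = triangleValue (c ⊕ ⊖ a) (a ⊕ ⊖ b) in a ≡ t 0F × b ≡ t 1F × c ≡ t 2F
triangle-unique = from-yes (all? λ a → all? λ b → all? λ c →
  ¬? (a ≟ z0) →-dec ¬? (b ≟ z0) →-dec ¬? (c ≟ z0) →-dec
  ¬? (c ⊕ ⊖ a ≟ z0) →-dec ¬? (a ⊕ ⊖ b ≟ z0) →-dec ¬? (b ⊕ ⊖ c ≟ z0) →-dec
  let t = triangleValue (c ⊕ ⊖ a) (a ⊕ ⊖ b) in (a ≟ t 0F) ×-dec (b ≟ t 1F) ×-dec (c ≟ t 2F))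

triangle-exists : ∀ X₀ X₁ X₂ → X₀ ≢ z0 → X₁ ≢ z0 → X₂ ≢ z0 → X₀ ⊕ (X₁ ⊕ X₂) ≡ z0 →
  let a = triangleValue X₀ X₁ 0F ; b = triangleValue X₀ X₁ 1F ; c = triangleValue X₀ X₁ 2F in
  a ≢ z0 × b ≢ z0 × c ≢ z0 ×
  (a ⊕ ⊖ c) ⊕ X₀ ≡ z0 × (b ⊕ ⊖ a) ⊕ X₁ ≡ z0 × (c ⊕ ⊖ b) ⊕ X₂ ≡ z0
triangle-exists = from-yes (all? λ X₀ → all? λ X₁ → all? λ X₂ →
  ¬? (X₀ ≟ z0) →-dec ¬? (X₁ ≟ z0) →-dec ¬? (X₂ ≟ z0) →-dec (X₀ ⊕ (X₁ ⊕ X₂) ≟ z0) →-dec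
  let a = triangleValue X₀ X₁ 0F ; b = triangleValue X₀ X₁ 1F ; c = triangleValue X₀ X₁ 2F in
  ¬? (a ≟ z0) ×-dec ¬? (b ≟ z0) ×-dec ¬? (c ≟ z0) ×-dec
  ((a ⊕ ⊖ c) ⊕ X₀ ≟ z0) ×-dec ((b ⊕ ⊖ a) ⊕ X₁ ≟ z0) ×-dec ((c ⊕ ⊖ b) ⊕ X₂ ≟ z0))

-- The three values are 1, 2, 3 in some order, so exactly one triangle arc is even.
triangle-odd : ∀ X₀ X₁ X₂ → X₀ ≢ z0 → X₁ ≢ z0 → X₂ ≢ z0 → X₀ ⊕ (X₁ ⊕ X₂) ≡ z0 →
  ∃[ t ] ∀ u → u ≢ t → odd (triangleValue X₀ X₁ u) ≡ true
triangle-odd = from-yes (all? λ X₀ → all? λ X₁ → all? λ X₂ →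
  ¬? (X₀ ≟ z0) →-dec ¬? (X₁ ≟ z0) →-dec ¬? (X₂ ≟ z0) →-dec (X₀ ⊕ (X₁ ⊕ X₂) ≟ z0) →-dec
  any? λ t → all? λ u → ¬? (u ≟ t) →-dec (odd (triangleValue X₀ X₁ u) Bool.≟ true))

boundary-odd : ∀ X₀ X₁ X₂ → X₀ ≢ z0 → X₁ ≢ z0 → X₂ ≢ z0 → X₀ ⊕ (X₁ ⊕ X₂) ≡ z0 →
  odd X₀ ≡ true ⊎ odd X₁ ≡ true
boundary-odd = from-yes (all? λ X₀ → all? λ X₁ → all? λ X₂ →
  ¬? (X₀ ≟ z0) →-dec ¬? (X₁ ≟ z0) →-dec ¬? (X₂ ≟ z0) →-dec (X₀ ⊕ (X₁ ⊕ X₂) ≟ z0) →-dec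
  ((odd X₀ Bool.≟ true) ⊎-dec (odd X₁ Bool.≟ true)))

-- s₀, s₁, s₂ mark the triangle arcs V₀V₁, V₁V₂, V₂V₀ and oₖ the remaining arc at Vₖ.
triangle-parity : ∀ s₀ s₁ s₂ o₀ o₁ o₂ →
  ZeroOrTwo ((𝟙 s₀ + 𝟙 s₂) + 𝟙 o₀) → ZeroOrTwo ((𝟙 s₀ + 𝟙 s₁) + 𝟙 o₁) → ZeroOrTwo ((𝟙 s₁ + 𝟙 s₂) + 𝟙 o₂) →
  ZeroOrTwo (𝟙 o₀ + (𝟙 o₁ + 𝟙 o₂))
triangle-parity = from-yes (allBool? λ s₀ → allBool? λ s₁ → allBool? λ s₂ → allBool? λ o₀ → allBool? λ o₁ → allBool? λ o₂ →
  zeroOrTwo? ((𝟙 s₀ + 𝟙 s₂) + 𝟙 o₀) →-dec zeroOrTwo? ((𝟙 s₀ + 𝟙 s₁) + 𝟙 o₁) →-dec zeroOrTwo? ((𝟙 s₁ + 𝟙 s₂) + 𝟙 o₂) →-dec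
  zeroOrTwo? (𝟙 o₀ + (𝟙 o₁ + 𝟙 o₂)))

-- Expanding a vertex into a triangle

listDeg : ∀ {k} → Edges k → Fin k → ℕ
listDeg [] y = 0
listDeg ((a , b) ∷ xs) y = (𝟙 (does (a ≟ y)) + 𝟙 (does (b ≟ y))) + listDeg xs y

deg≡listDeg : ∀ {k} (xs : Edges k) y → deg xs y ≡ listDeg xs y
deg≡listDeg [] y = refl
deg≡listDeg ((a , b) ∷ xs) y = cong (𝟙 (does (a ≟ y)) + 𝟙 (does (b ≟ y)) +_) (deg≡listDeg xs y)

ends≡1⇒endpoint : ∀ {k} (xs : Edges k) i y → ends xs i y ≡ 1 → tl xs i ≡ y ⊎ hd xs i ≡ y
ends≡1⇒endpoint xs i y e with tl xs i ≟ y | hd xs i ≟ y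
... | yes tl≡y | _ = inj₁ tl≡y
... | no _ | yes hd≡y = inj₂ hd≡y
ends≡1⇒endpoint xs i y () | no _ | no _

if-0 : ∀ b → (if b then 0 else 0) ≡ 0
if-0 true = refl
if-0 false = refl

if-+ : ∀ b p q → (if b then p + q else 0) ≡ (if b then p else 0) + (if b then q else 0)
if-+ true p q = refl
if-+ false p q = refl

module Expansion {n} (es : Edges n) (v : Fin n) where

  collapse : Fin (suc (suc n)) → Fin n
  collapse zero = v
  collapse (suc zero) = v
  collapse (suc (suc x)) = x

  collapse-newV : ∀ c → collapse (newV v c) ≡ v
  collapse-newV zero = refl
  collapse-newV (suc zero) = refl
  collapse-newV (suc (suc c)) = refl

  Collapses : Fin (suc (suc n)) × Fin (suc (suc n)) → Fin n × Fin n → Set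
  Collapses (a′ , b′) (a , b) = collapse a′ ≡ a × collapse b′ ≡ b

  private
    at-v : ∀ {a} → does (a ≟ v) ≡ true → v ≡ a
    at-v {a} e with a ≟ v
    at-v {a} refl | yes a≡v = sym a≡v

  expandGo-collapses : ∀ c xs → Pointwise Collapses (expandGo v c xs) xs
  expandGo-collapses c [] = []
  expandGo-collapses c ((a , b) ∷ xs) with does (a ≟ v) in a≟v | does (b ≟ v) in b≟v
  ... | true  | true  = (trans (collapse-newV c) (at-v a≟v) , trans (collapse-newV (suc c)) (at-v b≟v)) ∷ expandGo-collapses _ xs
  ... | true  | false = (trans (collapse-newV c) (at-v a≟v) , refl) ∷ expandGo-collapses _ xs
  ... | false | true  = (refl , trans (collapse-newV c) (at-v b≟v)) ∷ expandGo-collapses _ xs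
  ... | false | false = (refl , refl) ∷ expandGo-collapses _ xs

  v≟v : does (v ≟ v) ≡ true
  v≟v = dec-true (v ≟ v) refl

  v≟ : ∀ {x} → x ≢ v → does (v ≟ x) ≡ false
  v≟ {x} x≢v = dec-false (v ≟ x) (x≢v ∘ sym)

  V : Fin 3 → Fin (suc (suc n))
  V 0F = shift v
  V 1F = zero
  V 2F = suc zero

  reattached : Edges (suc (suc n))
  reattached = expandGo v 0 es

  triangle : Edges (suc (suc n))
  triangle = (V 0F , V 1F) ∷ (V 1F , V 2F) ∷ (V 2F , V 0F) ∷ []

  expanded : Edges (suc (suc n))
  expanded = triangle ++ reattached

  -- expandGo reattaches the successive arc-ends at v to newV v c, newV v (c + 1), …
  newHits : ℕ → ℕ → Fin (suc (suc n)) → ℕ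
  newHits c zero y = 0
  newHits c (suc e) y = 𝟙 (does (newV v c ≟ y)) + newHits (suc c) e y

  listDeg-expandGo : ∀ y → (∀ b → does (b ≟ v) ≡ false → does (shift b ≟ y) ≡ false) →
                     ∀ c xs → listDeg (expandGo v c xs) y ≡ newHits c (listDeg xs v) y
  listDeg-expandGo y fresh c [] = refl
  listDeg-expandGo y fresh c ((a , b) ∷ xs) with does (a ≟ v) in a≟v | does (b ≟ v) in b≟v
  ... | true | true = trans (ℕ.+-assoc (𝟙 (does (newV v c ≟ y))) _ _)
    (cong (λ z → 𝟙 (does (newV v c ≟ y)) + (𝟙 (does (newV v (suc c) ≟ y)) + z))
          (listDeg-expandGo y fresh (suc (suc c)) xs))
  ... | true | false rewrite fresh b b≟v =
    trans (cong (_+ listDeg (expandGo v (suc c) xs) y) (ℕ.+-identityʳ (𝟙 (does (newV v c ≟ y)))))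
          (cong (𝟙 (does (newV v c ≟ y)) +_) (listDeg-expandGo y fresh (suc c) xs))
  ... | false | true rewrite fresh a a≟v = cong (𝟙 (does (newV v c ≟ y)) +_) (listDeg-expandGo y fresh (suc c) xs)
  ... | false | false rewrite fresh a a≟v | fresh b b≟v = listDeg-expandGo y fresh c xs

  V-fresh : ∀ k b → does (b ≟ v) ≡ false → does (shift b ≟ V k) ≡ false
  V-fresh 0F b e = e
  V-fresh 1F b e = refl
  V-fresh 2F b e = refl

  newHits-V : ∀ k → newHits 0 3 (V k) ≡ 1
  newHits-V 0F rewrite v≟v = refl
  newHits-V 1F = refl
  newHits-V 2F = refl

  deg-reattached-V : deg es v ≡ 3 → ∀ k → deg reattached (V k) ≡ 1
  deg-reattached-V deg-v k = begin
    deg reattached (V k)             ≡⟨ deg≡listDeg reattached (V k) ⟩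
    listDeg reattached (V k)         ≡⟨ listDeg-expandGo (V k) (V-fresh k) 0 es ⟩
    newHits 0 (listDeg es v) (V k)   ≡⟨ cong (λ d → newHits 0 d (V k)) (trans (sym (deg≡listDeg es v)) deg-v) ⟩
    newHits 0 3 (V k)                ≡⟨ newHits-V k ⟩
    1                                ∎
    where open ≡-Reasoning

  m mL : ℕ
  m = length es
  mL = length reattached

  collapses : Pointwise Collapses reattached es
  collapses = expandGo-collapses 0 es

  ρ-perm : Permutation mL m
  ρ-perm = Perm.cast-id (Pointwise.Pointwise-length collapses)

  ρ : Fin mL → Fin m
  ρ = ρ-perm ⟨$⟩ʳ_

  ρ⁻ : Fin m → Fin mL
  ρ⁻ = ρ-perm ⟨$⟩ˡ_

  ρ-ρ⁻ : ∀ j → ρ (ρ⁻ j) ≡ j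
  ρ-ρ⁻ j = Perm.inverseʳ ρ-perm

  old : Fin mL → Fin (length expanded)
  old i = suc (suc (suc i))

  triArc : Fin 3 → Fin (length expanded)
  triArc 0F = 0F
  triArc 1F = 1F
  triArc 2F = 2F

  collapse-tl : ∀ i → collapse (tl reattached i) ≡ tl es (ρ i)
  collapse-tl i = proj₁ (Pointwise.lookup-cast collapses _ i)

  collapse-hd : ∀ i → collapse (hd reattached i) ≡ hd es (ρ i)
  collapse-hd i = proj₂ (Pointwise.lookup-cast collapses _ i)

  collapse-tl′ : ∀ i → collapse (tl reattached (ρ⁻ i)) ≡ tl es i
  collapse-tl′ i = trans (collapse-tl (ρ⁻ i)) (cong (tl es) (ρ-ρ⁻ i))

  collapse-hd′ : ∀ i → collapse (hd reattached (ρ⁻ i)) ≡ hd es i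
  collapse-hd′ i = trans (collapse-hd (ρ⁻ i)) (cong (hd es) (ρ-ρ⁻ i))

  does-shift : ∀ y x → x ≢ v → does (y ≟ shift x) ≡ does (collapse y ≟ x)
  does-shift zero x x≢v = sym (v≟ x≢v)
  does-shift (suc zero) x x≢v = sym (v≟ x≢v)
  does-shift (suc (suc z)) x x≢v = refl

  collapse-V : ∀ k → collapse (V k) ≡ v
  collapse-V 0F = refl
  collapse-V 1F = refl
  collapse-V 2F = refl

  collapse-injective : ∀ y₁ y₂ → collapse y₁ ≡ collapse y₂ → collapse y₁ ≢ v → y₁ ≡ y₂
  collapse-injective zero y₂ e ≢v = ⊥-elim (≢v refl)
  collapse-injective (suc zero) y₂ e ≢v = ⊥-elim (≢v refl)
  collapse-injective (suc (suc x)) zero e ≢v = ⊥-elim (≢v e)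
  collapse-injective (suc (suc x)) (suc zero) e ≢v = ⊥-elim (≢v e)
  collapse-injective (suc (suc x)) (suc (suc y)) e ≢v = cong shift e

  sel-V : ∀ y u → sel (does (y ≟ V 0F)) u ⊕ (sel (does (y ≟ V 1F)) u ⊕ sel (does (y ≟ V 2F)) u)
                ≡ sel (does (collapse y ≟ v)) u
  sel-V zero u rewrite v≟v = ⊕-identityʳ u
  sel-V (suc zero) u rewrite v≟v = refl
  sel-V (suc (suc z)) u = ⊕-identityʳ _

  𝟙-V : ∀ y → 𝟙 (does (y ≟ V 0F)) + (𝟙 (does (y ≟ V 1F)) + 𝟙 (does (y ≟ V 2F))) ≡ 𝟙 (does (collapse y ≟ v))
  𝟙-V zero rewrite v≟v = refl
  𝟙-V (suc zero) rewrite v≟v = refl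
  𝟙-V (suc (suc z)) = ℕ.+-identityʳ _

  oldContrib : (Fin mL → Z4) → Fin mL → Fin (suc (suc n)) → Z4
  oldContrib g i y = sel (does (tl reattached i ≟ y)) (g i) ⊕ ⊖ sel (does (hd reattached i ≟ y)) (g i)

  oldNet : (Fin mL → Z4) → Fin (suc (suc n)) → Z4
  oldNet g y = ΣZ.sum λ i → oldContrib g i y

  oldNet-cong : ∀ {g h} → (∀ i → g i ≡ h i) → ∀ y → oldNet g y ≡ oldNet h y
  oldNet-cong g≗h y = ΣZ.sum-cong-≗ λ i → cong (λ u → sel (does (tl reattached i ≟ y)) u ⊕ ⊖ sel (does (hd reattached i ≟ y)) u) (g≗h i)

  pull : Z4Map es → Fin mL → Z4
  pull f i = lookup f (ρ i)

  contrib-shift : ∀ f i x → x ≢ v → contrib es f (ρ i) x ≡ oldContrib (pull f) i (shift x)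
  contrib-shift f i x x≢v rewrite does-shift (tl reattached i) x x≢v | does-shift (hd reattached i) x x≢v
    | collapse-tl i | collapse-hd i = refl

  contrib-v : ∀ f i → contrib es f (ρ i) v ≡
              oldContrib (pull f) i (V 0F) ⊕ (oldContrib (pull f) i (V 1F) ⊕ oldContrib (pull f) i (V 2F))
  contrib-v f i = begin
      contrib es f (ρ i) v
        ≡⟨ cong₂ (λ p q → sel (does (p ≟ v)) u ⊕ ⊖ sel (does (q ≟ v)) u) (collapse-tl i) (collapse-hd i) ⟨
      sel (does (collapse yt ≟ v)) u ⊕ ⊖ sel (does (collapse yh ≟ v)) u
        ≡⟨ cong₂ (λ p q → p ⊕ ⊖ q) (sel-V yt u) (sel-V yh u) ⟨
      (p 0F ⊕ (p 1F ⊕ p 2F)) ⊕ ⊖ (q 0F ⊕ (q 1F ⊕ q 2F))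
        ≡⟨ ⊕-⊖-interchange₃ (p 0F) (p 1F) (p 2F) (q 0F) (q 1F) (q 2F) ⟩
      oldContrib (pull f) i (V 0F) ⊕ (oldContrib (pull f) i (V 1F) ⊕ oldContrib (pull f) i (V 2F)) ∎
    where
    open ≡-Reasoning
    u = pull f i
    yt = tl reattached i
    yh = hd reattached i
    p q : Fin 3 → Z4
    p k = sel (does (yt ≟ V k)) u
    q k = sel (does (yh ≟ V k)) u

  net-shift : ∀ f x → x ≢ v → net es f x ≡ oldNet (pull f) (shift x)
  net-shift f x x≢v = trans (ΣZ.∑-permute (λ j → contrib es f j x) ρ-perm) (ΣZ.sum-cong-≗ λ i → contrib-shift f i x x≢v)

  net-v : ∀ f → net es f v ≡ oldNet (pull f) (V 0F) ⊕ (oldNet (pull f) (V 1F) ⊕ oldNet (pull f) (V 2F))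
  net-v f = begin
    net es f v                                        ≡⟨ ΣZ.∑-permute (λ j → contrib es f j v) ρ-perm ⟩
    ΣZ.sum (λ i → contrib es f (ρ i) v)               ≡⟨ ΣZ.sum-cong-≗ (contrib-v f) ⟩
    ΣZ.sum (λ i → c 0F i ⊕ (c 1F i ⊕ c 2F i))         ≡⟨ ΣZ.∑-distrib-+ (c 0F) (λ i → c 1F i ⊕ c 2F i) ⟩
    oldNet g (V 0F) ⊕ ΣZ.sum (λ i → c 1F i ⊕ c 2F i)  ≡⟨ cong (oldNet g (V 0F) ⊕_) (ΣZ.∑-distrib-+ (c 1F) (c 2F)) ⟩
    oldNet g (V 0F) ⊕ (oldNet g (V 1F) ⊕ oldNet g (V 2F)) ∎
    where
    open ≡-Reasoning
    g = pull f
    c : Fin 3 → Fin mL → Z4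
    c k i = oldContrib g i (V k)

  oldValues : Z4Map expanded → Fin mL → Z4
  oldValues f′ i = lookup f′ (old i)

  private
    rotate : ∀ a b X → ⊖ a ⊕ ((b ⊕ z0) ⊕ X) ≡ (b ⊕ ⊖ a) ⊕ X
    rotate a b X rewrite ⊕-identityʳ b = trans (sym (⊕-assoc (⊖ a) b X)) (cong (_⊕ X) (⊕-comm (⊖ a) b))

  net-V₀ : ∀ f′ → net expanded f′ (V 0F) ≡ (lookup f′ 0F ⊕ ⊖ lookup f′ 2F) ⊕ oldNet (oldValues f′) (V 0F)
  net-V₀ f′ rewrite v≟v = trans (cong (_⊕ (⊖ c ⊕ X)) (⊕-identityʳ a)) (sym (⊕-assoc a (⊖ c) X))
    where
    a = lookup f′ 0F
    c = lookup f′ 2F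
    X = oldNet (oldValues f′) (V 0F)

  net-V₁ : ∀ f′ → net expanded f′ (V 1F) ≡ (lookup f′ 1F ⊕ ⊖ lookup f′ 0F) ⊕ oldNet (oldValues f′) (V 1F)
  net-V₁ f′ = rotate (lookup f′ 0F) (lookup f′ 1F) (oldNet (oldValues f′) (V 1F))

  net-V₂ : ∀ f′ → net expanded f′ (V 2F) ≡ (lookup f′ 2F ⊕ ⊖ lookup f′ 1F) ⊕ oldNet (oldValues f′) (V 2F)
  net-V₂ f′ = rotate (lookup f′ 1F) (lookup f′ 2F) (oldNet (oldValues f′) (V 2F))

  net-shift′ : ∀ f′ x → x ≢ v → net expanded f′ (shift x) ≡ oldNet (oldValues f′) (shift x)
  net-shift′ f′ x x≢v rewrite v≟ x≢v = refl

  oldDegS : (Fin mL → Bool) → Fin (suc (suc n)) → ℕ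
  oldDegS β y = Σℕ.sum λ i → if β i then ends reattached i y else 0

  oldBits : EdgeSet expanded → Fin mL → Bool
  oldBits S′ i = lookup S′ (old i)

  old-in : ∀ {S S′} → (∀ i → oldBits S′ i ≡ lookup S (ρ i)) → ∀ {i} → InS es S i → InS expanded S′ (old (ρ⁻ i))
  old-in {S} old-bit {i} i∈S = trans (old-bit (ρ⁻ i)) (trans (cong (lookup S) (ρ-ρ⁻ i)) i∈S)

  ends-shift : ∀ i x → x ≢ v → ends es (ρ i) x ≡ ends reattached i (shift x)
  ends-shift i x x≢v rewrite does-shift (tl reattached i) x x≢v | does-shift (hd reattached i) x x≢v
    | collapse-tl i | collapse-hd i = refl

  ends-v : ∀ i → ends es (ρ i) v ≡ ends reattached i (V 0F) + (ends reattached i (V 1F) + ends reattached i (V 2F))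
  ends-v i = begin
      ends es (ρ i) v
        ≡⟨ cong₂ (λ p q → 𝟙 (does (p ≟ v)) + 𝟙 (does (q ≟ v))) (collapse-tl i) (collapse-hd i) ⟨
      𝟙 (does (collapse yt ≟ v)) + 𝟙 (does (collapse yh ≟ v))
        ≡⟨ cong₂ _+_ (𝟙-V yt) (𝟙-V yh) ⟨
      (p 0F + (p 1F + p 2F)) + (q 0F + (q 1F + q 2F))
        ≡⟨ interchange₃ ℕ.+-0-commutativeMonoid (p 0F) (p 1F) (p 2F) (q 0F) (q 1F) (q 2F) ⟩
      ends reattached i (V 0F) + (ends reattached i (V 1F) + ends reattached i (V 2F)) ∎
    where
    open ≡-Reasoning
    yt = tl reattached i
    yh = hd reattached i
    p q : Fin 3 → ℕ
    p k = 𝟙 (does (yt ≟ V k))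
    q k = 𝟙 (does (yh ≟ V k))

  deg-shift : ∀ x → x ≢ v → deg es x ≡ deg reattached (shift x)
  deg-shift x x≢v = trans (Σℕ.∑-permute (λ j → ends es j x) ρ-perm) (Σℕ.sum-cong-≗ λ i → ends-shift i x x≢v)

  degS-shift : ∀ S x → x ≢ v → degS es S x ≡ oldDegS (lookup S ∘ ρ) (shift x)
  degS-shift S x x≢v = trans (Σℕ.∑-permute (λ j → if lookup S j then ends es j x else 0) ρ-perm)
    (Σℕ.sum-cong-≗ λ i → cong (λ e → if lookup S (ρ i) then e else 0) (ends-shift i x x≢v))

  degS-v : ∀ S → let β = lookup S ∘ ρ in degS es S v ≡ oldDegS β (V 0F) + (oldDegS β (V 1F) + oldDegS β (V 2F))
  degS-v S = begin
      degS es S v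
        ≡⟨ Σℕ.∑-permute (λ j → if lookup S j then ends es j v else 0) ρ-perm ⟩
      Σℕ.sum (λ i → if β i then ends es (ρ i) v else 0)
        ≡⟨ Σℕ.sum-cong-≗ (λ i → trans (cong (λ e → if β i then e else 0) (ends-v i))
                                      (trans (if-+ (β i) _ _) (cong (e 0F i +_) (if-+ (β i) _ _)))) ⟩
      Σℕ.sum (λ i → e 0F i + (e 1F i + e 2F i))
        ≡⟨ Σℕ.∑-distrib-+ (e 0F) (λ i → e 1F i + e 2F i) ⟩
      oldDegS β (V 0F) + Σℕ.sum (λ i → e 1F i + e 2F i)
        ≡⟨ cong (oldDegS β (V 0F) +_) (Σℕ.∑-distrib-+ (e 1F) (e 2F)) ⟩
      oldDegS β (V 0F) + (oldDegS β (V 1F) + oldDegS β (V 2F)) ∎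
    where
    open ≡-Reasoning
    β = lookup S ∘ ρ
    e : Fin 3 → Fin mL → ℕ
    e k i = if β i then ends reattached i (V k) else 0

  module _ (S′ : EdgeSet expanded) where
    private
      s : Fin 3 → Bool
      s t = lookup S′ (triArc t)

    degS-V₀ : degS expanded S′ (V 0F) ≡ (𝟙 (s 0F) + 𝟙 (s 2F)) + oldDegS (oldBits S′) (V 0F)
    degS-V₀ rewrite v≟v | if-0 (s 1F) = sym (ℕ.+-assoc (𝟙 (s 0F)) (𝟙 (s 2F)) _)

    degS-V₁ : degS expanded S′ (V 1F) ≡ (𝟙 (s 0F) + 𝟙 (s 1F)) + oldDegS (oldBits S′) (V 1F)
    degS-V₁ rewrite if-0 (s 2F) = sym (ℕ.+-assoc (𝟙 (s 0F)) (𝟙 (s 1F)) _)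

    degS-V₂ : degS expanded S′ (V 2F) ≡ (𝟙 (s 1F) + 𝟙 (s 2F)) + oldDegS (oldBits S′) (V 2F)
    degS-V₂ rewrite if-0 (s 0F) = sym (ℕ.+-assoc (𝟙 (s 1F)) (𝟙 (s 2F)) _)

    degS-shift′ : ∀ x → x ≢ v → degS expanded S′ (shift x) ≡ oldDegS (oldBits S′) (shift x)
    degS-shift′ x x≢v rewrite v≟ x≢v | if-0 (s 0F) | if-0 (s 1F) | if-0 (s 2F) = refl

  restrict : Z4Map expanded → Z4Map es
  restrict f′ = tabulate λ j → lookup f′ (old (ρ⁻ j))

  pull-restrict : ∀ f′ i → pull (restrict f′) i ≡ oldValues f′ i
  pull-restrict f′ i = trans (Vec.lookup∘tabulate _ (ρ i)) (cong (λ z → lookup f′ (old z)) (Perm.inverseˡ ρ-perm))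

  boundary : Z4Map es → Fin 3 → Z4
  boundary f k = oldNet (pull f) (V k)

  extend : Z4Map es → Z4Map expanded
  extend f = t 0F ∷ t 1F ∷ t 2F ∷ tabulate (pull f)
    where t = triangleValue (boundary f 0F) (boundary f 1F)

  extend-triArc : ∀ f t → lookup (extend f) (triArc t) ≡ triangleValue (boundary f 0F) (boundary f 1F) t
  extend-triArc f 0F = refl
  extend-triArc f 1F = refl
  extend-triArc f 2F = refl

  oldValues-extend : ∀ f i → oldValues (extend f) i ≡ pull f i
  oldValues-extend f i = Vec.lookup∘tabulate (pull f) i

  restrict-extend : ∀ f → restrict (extend f) ≡ f
  restrict-extend f = vec-ext λ j → trans (Vec.lookup∘tabulate _ j)
    (trans (oldValues-extend f (ρ⁻ j)) (cong (lookup f) (ρ-ρ⁻ j)))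

  restrict-neg : ∀ f′ → restrict (neg expanded f′) ≡ neg es (restrict f′)
  restrict-neg f′ = vec-ext λ j → trans (Vec.lookup∘tabulate _ j)
    (trans (lookup-neg expanded f′ (old (ρ⁻ j)))
           (sym (trans (lookup-neg es (restrict f′) j) (cong ⊖_ (Vec.lookup∘tabulate _ j)))))

  contract : ∀ {S S′ y z} → (∀ i → oldBits S′ i ≡ lookup S (ρ i)) →
             Reach expanded S′ y z → Reach es S (collapse y) (collapse z)
  contract old-bit here = here
  contract old-bit (fwd 0F _ p) = contract old-bit p
  contract old-bit (fwd 1F _ p) = contract old-bit p
  contract old-bit (fwd 2F _ p) = contract old-bit p
  contract {S} old-bit (fwd (suc (suc (suc i))) i∈S′ p) =
    subst (λ z → Reach es S z _) (sym (collapse-tl i))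
      (fwd (ρ i) (trans (sym (old-bit i)) i∈S′) (subst (λ z → Reach es S z _) (collapse-hd i) (contract old-bit p)))
  contract old-bit (bwd 0F _ p) = contract old-bit p
  contract old-bit (bwd 1F _ p) = contract old-bit p
  contract old-bit (bwd 2F _ p) = contract old-bit p
  contract {S} old-bit (bwd (suc (suc (suc i))) i∈S′ p) =
    subst (λ z → Reach es S z _) (sym (collapse-hd i))
      (bwd (ρ i) (trans (sym (old-bit i)) i∈S′) (subst (λ z → Reach es S z _) (collapse-tl i) (contract old-bit p)))

  lift : ∀ {S S′} → (∀ i → oldBits S′ i ≡ lookup S (ρ i)) →
         (∀ y₁ y₂ → collapse y₁ ≡ collapse y₂ → Reach expanded S′ y₁ y₂) →
         ∀ {x y} → Reach es S x y → ∀ y₁ y₂ → collapse y₁ ≡ x → collapse y₂ ≡ y → Reach expanded S′ y₁ y₂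
  lift old-bit fiber here y₁ y₂ e₁ e₂ = fiber y₁ y₂ (trans e₁ (sym e₂))
  lift {S} {S′} old-bit fiber (fwd i i∈S p) y₁ y₂ e₁ e₂ =
    Reach-trans expanded (fiber y₁ (tl reattached (ρ⁻ i)) (trans e₁ (sym (collapse-tl′ i))))
      (fwd (old (ρ⁻ i)) (old-in {S} {S′} old-bit i∈S) (lift {S} {S′} old-bit fiber p (hd reattached (ρ⁻ i)) y₂ (collapse-hd′ i) e₂))
  lift {S} {S′} old-bit fiber (bwd i i∈S p) y₁ y₂ e₁ e₂ =
    Reach-trans expanded (fiber y₁ (hd reattached (ρ⁻ i)) (trans e₁ (sym (collapse-hd′ i))))
      (bwd (old (ρ⁻ i)) (old-in {S} {S′} old-bit i∈S) (lift {S} {S′} old-bit fiber p (tl reattached (ρ⁻ i)) y₂ (collapse-tl′ i) e₂))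

  triangle-reach : ∀ S′ t → (∀ u → u ≢ t → InS expanded S′ (triArc u)) → ∀ k → Reach expanded S′ (V k) (V 0F)
  triangle-reach S′ t arc 0F = here
  triangle-reach S′ 0F arc 1F = fwd 1F (arc 1F λ ()) (fwd 2F (arc 2F λ ()) here)
  triangle-reach S′ 0F arc 2F = fwd 2F (arc 2F λ ()) here
  triangle-reach S′ 1F arc 1F = bwd 0F (arc 0F λ ()) here
  triangle-reach S′ 1F arc 2F = fwd 2F (arc 2F λ ()) here
  triangle-reach S′ 2F arc 1F = bwd 0F (arc 0F λ ()) here
  triangle-reach S′ 2F arc 2F = bwd 1F (arc 1F λ ()) (bwd 0F (arc 0F λ ()) here)

  oddSupport-old-bit : ∀ f′ i → oldBits (oddSupport expanded f′) i ≡ lookup (oddSupport es (restrict f′)) (ρ i)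
  oddSupport-old-bit f′ i = trans (lookup-oddSupport expanded f′ (old i))
    (sym (trans (lookup-oddSupport es (restrict f′) (ρ i)) (cong odd (pull-restrict f′ i))))

  lift-connected : ∀ {S S′} → (∀ i → oldBits S′ i ≡ lookup S (ρ i)) →
                   (∀ y₁ y₂ → collapse y₁ ≡ collapse y₂ → Reach expanded S′ y₁ y₂) →
                   (∃[ i ] InS es S i × Reach es S v (tl es i)) →
                   Connected es S → Connected expanded S′
  lift-connected {S} {S′} old-bit fiber at-v connected j₁ j₂ j₁∈ j₂∈ =
    let (i₁ , i₁∈ , q₁) = anchor j₁ j₁∈
        (i₂ , i₂∈ , q₂) = anchor j₂ j₂∈
    in lift {S} {S′} old-bit fiber (Reach-trans es q₁ (Reach-trans es (connected i₁ i₂ i₁∈ i₂∈) (Reach-sym es q₂))) _ _ refl refl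
    where
    anchor : ∀ j → InS expanded S′ j → ∃[ i ] InS es S i × Reach es S (collapse (tl expanded j)) (tl es i)
    anchor 0F _ = at-v
    anchor 1F _ = at-v
    anchor 2F _ = at-v
    anchor (suc (suc (suc i))) j∈ = ρ i , trans (sym (old-bit i)) j∈ ,
      subst (λ z → Reach es S z (tl es (ρ i))) (sym (collapse-tl i)) here

  module _ (cubic : ∀ x → deg es x ≡ 3) where

    atV-unique : ∀ k → Σ (Fin mL) λ i → ends reattached i (V k) ≡ 1 × (∀ j → j ≢ i → ends reattached j (V k) ≡ 0)
    atV-unique k = Σℕ≡1⇒single (λ i → ends reattached i (V k)) (deg-reattached-V (cubic v) k)

    atV : Fin 3 → Fin mL
    atV k = proj₁ (atV-unique k)

    cubic′ : ∀ y → deg expanded y ≡ 3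
    cubic′ zero = cong (λ d → 1 + (1 + (0 + d))) (deg-reattached-V (cubic v) 1F)
    cubic′ (suc zero) = cong (λ d → 0 + (1 + (1 + d))) (deg-reattached-V (cubic v) 2F)
    cubic′ (suc (suc x)) with x ≟ v
    ... | yes refl rewrite v≟v = cong (λ d → 1 + (0 + (1 + d))) (deg-reattached-V (cubic v) 0F)
    ... | no x≢v rewrite v≟ x≢v = trans (sym (deg-shift x x≢v)) (cubic x)

    oldNet-V : ∀ g k → Σ Bool λ r → oldNet g (V k) ≡ sgn r (g (atV k))
    oldNet-V g k with atV-unique k
    ... | i , ends≡1 , others≡0 = r , trans (sum-single Z4-commutativeMonoid _ i λ j j≢i → silent (others≡0 j j≢i)) (proj₂ at-i)
      where
      silent : ∀ {j} → ends reattached j (V k) ≡ 0 → oldContrib g j (V k) ≡ z0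
      silent {j} e with does (tl reattached j ≟ V k) | does (hd reattached j ≟ V k)
      silent () | true | _
      silent () | false | true
      ... | false | false = refl
      signed : ∀ bt bh → 𝟙 bt + 𝟙 bh ≡ 1 → Σ Bool λ r → sel bt (g i) ⊕ ⊖ sel bh (g i) ≡ sgn r (g i)
      signed true false _ = false , ⊕-identityʳ (g i)
      signed false true _ = true , refl
      at-i = signed (does (tl reattached i ≟ V k)) (does (hd reattached i ≟ V k)) ends≡1
      r = proj₁ at-i

    oldNet-nonzero : ∀ g k → g (atV k) ≢ z0 → oldNet g (V k) ≢ z0
    oldNet-nonzero g k g≢0 with oldNet-V g k
    ... | r , e = λ X≡0 → sgn-nonzero r _ g≢0 (trans (sym e) X≡0)

    odd-oldNet : ∀ g k → odd (oldNet g (V k)) ≡ odd (g (atV k))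
    odd-oldNet g k with oldNet-V g k
    ... | r , e = trans (cong odd e) (odd-sgn r (g (atV k)))

    oldDegS-V : ∀ β k → oldDegS β (V k) ≡ 𝟙 (β (atV k))
    oldDegS-V β k with atV-unique k
    ... | i , ends≡1 , others≡0 = trans
      (sum-single ℕ.+-0-commutativeMonoid _ i λ j j≢i →
        trans (cong (λ e → if β j then e else 0) (others≡0 j j≢i)) (if-0 (β j)))
      (cong (λ e → if β i then e else 0) ends≡1)

    boundary′ : Z4Map expanded → Fin 3 → Z4
    boundary′ f′ k = oldNet (oldValues f′) (V k)

    boundary-restrict : ∀ f′ k → boundary (restrict f′) k ≡ boundary′ f′ k
    boundary-restrict f′ k = oldNet-cong (pull-restrict f′) (V k)

    boundary′-nonzero : ∀ f′ → NowhereZero expanded f′ → ∀ k → boundary′ f′ k ≢ z0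
    boundary′-nonzero f′ nz k = oldNet-nonzero (oldValues f′) k (nz (old (atV k)))

    module _ (f′ : Z4Map expanded) (flow : IsZ4Flow expanded f′) where
      private
        a = lookup f′ 0F
        b = lookup f′ 1F
        c = lookup f′ 2F

      boundary′₀ : boundary′ f′ 0F ≡ c ⊕ ⊖ a
      boundary′₀ = Kirchhoff-solve a c (boundary′ f′ 0F) (trans (sym (net-V₀ f′)) (flow⇒net≡0 expanded f′ flow (V 0F)))

      boundary′₁ : boundary′ f′ 1F ≡ a ⊕ ⊖ b
      boundary′₁ = Kirchhoff-solve b a (boundary′ f′ 1F) (trans (sym (net-V₁ f′)) (flow⇒net≡0 expanded f′ flow (V 1F)))

      boundary′₂ : boundary′ f′ 2F ≡ b ⊕ ⊖ c
      boundary′₂ = Kirchhoff-solve c b (boundary′ f′ 2F) (trans (sym (net-V₂ f′)) (flow⇒net≡0 expanded f′ flow (V 2F)))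

      boundary′-sum : boundary′ f′ 0F ⊕ (boundary′ f′ 1F ⊕ boundary′ f′ 2F) ≡ z0
      boundary′-sum = trans (cong₂ _⊕_ boundary′₀ (cong₂ _⊕_ boundary′₁ boundary′₂)) (telescope a b c)

      triangle-canonical : NowhereZero expanded f′ → ∀ t →
                           lookup f′ (triArc t) ≡ triangleValue (boundary′ f′ 0F) (boundary′ f′ 1F) t
      triangle-canonical nz t = trans (solved t) (cong₂ (λ p q → triangleValue p q t) (sym boundary′₀) (sym boundary′₁))
        where
        nonzero : ∀ k {Y} → boundary′ f′ k ≡ Y → Y ≢ z0
        nonzero k e = subst (_≢ z0) e (boundary′-nonzero f′ nz k)
        unique = triangle-unique a b c (nz 0F) (nz 1F) (nz 2F)
                   (nonzero 0F boundary′₀) (nonzero 1F boundary′₁) (nonzero 2F boundary′₂)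
        solved : ∀ t → lookup f′ (triArc t) ≡ triangleValue (c ⊕ ⊖ a) (a ⊕ ⊖ b) t
        solved 0F = proj₁ unique
        solved 1F = proj₁ (proj₂ unique)
        solved 2F = proj₂ (proj₂ unique)

    extend-nzFlow : ∀ f → NZFlow es f → NZFlow expanded (extend f)
    extend-nzFlow f (flow , nz) = net≡0⇒flow expanded (extend f) balanced , nonzero
      where
      boundary≢0 : ∀ k → boundary f k ≢ z0
      boundary≢0 k = oldNet-nonzero (pull f) k (nz (ρ (atV k)))
      E = triangle-exists (boundary f 0F) (boundary f 1F) (boundary f 2F) (boundary≢0 0F) (boundary≢0 1F) (boundary≢0 2F)
            (trans (sym (net-v f)) (flow⇒net≡0 es f flow v))
      t = lookup (extend f)
      kirchhoff₀ : (t 0F ⊕ ⊖ t 2F) ⊕ boundary f 0F ≡ z0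
      kirchhoff₀ = proj₁ (proj₂ (proj₂ (proj₂ E)))
      kirchhoff₁ : (t 1F ⊕ ⊖ t 0F) ⊕ boundary f 1F ≡ z0
      kirchhoff₁ = proj₁ (proj₂ (proj₂ (proj₂ (proj₂ E))))
      kirchhoff₂ : (t 2F ⊕ ⊖ t 1F) ⊕ boundary f 2F ≡ z0
      kirchhoff₂ = proj₂ (proj₂ (proj₂ (proj₂ (proj₂ E))))
      old-net : ∀ y → oldNet (oldValues (extend f)) y ≡ oldNet (pull f) y
      old-net = oldNet-cong (oldValues-extend f)
      balanced : ∀ y → net expanded (extend f) y ≡ z0
      balanced zero = trans (net-V₁ (extend f))
        (trans (cong ((t 1F ⊕ ⊖ t 0F) ⊕_) (old-net (V 1F))) kirchhoff₁)
      balanced (suc zero) = trans (net-V₂ (extend f))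
        (trans (cong ((t 2F ⊕ ⊖ t 1F) ⊕_) (old-net (V 2F))) kirchhoff₂)
      balanced (suc (suc x)) with x ≟ v
      ... | yes refl = trans (net-V₀ (extend f))
        (trans (cong ((t 0F ⊕ ⊖ t 2F) ⊕_) (old-net (V 0F))) kirchhoff₀)
      ... | no x≢v = trans (net-shift′ (extend f) x x≢v)
        (trans (old-net (shift x)) (trans (sym (net-shift f x x≢v)) (flow⇒net≡0 es f flow x)))
      nonzero : NowhereZero expanded (extend f)
      nonzero 0F = proj₁ E
      nonzero 1F = proj₁ (proj₂ E)
      nonzero 2F = proj₁ (proj₂ (proj₂ E))
      nonzero (suc (suc (suc i))) e = nz (ρ i) (trans (sym (oldValues-extend f i)) e)

    restrict-nzFlow : ∀ f′ → NZFlow expanded f′ → NZFlow es (restrict f′)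
    restrict-nzFlow f′ (flow , nz) = net≡0⇒flow es (restrict f′) balanced , nonzero
      where
      balanced : ∀ x → net es (restrict f′) x ≡ z0
      balanced x with x ≟ v
      ... | yes refl = trans (net-v (restrict f′))
        (trans (cong₂ _⊕_ (boundary-restrict f′ 0F) (cong₂ _⊕_ (boundary-restrict f′ 1F) (boundary-restrict f′ 2F)))
               (boundary′-sum f′ flow))
      ... | no x≢v = trans (net-shift (restrict f′) x x≢v) (trans (oldNet-cong (pull-restrict f′) (shift x))
        (trans (sym (net-shift′ f′ x x≢v)) (flow⇒net≡0 expanded f′ flow (shift x))))
      nonzero : NowhereZero es (restrict f′)
      nonzero j e = nz (old (ρ⁻ j)) (trans (sym (Vec.lookup∘tabulate _ j)) e)

    canonical : ∀ f′ → NZFlow expanded f′ → f′ ≡ extend (restrict f′)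
    canonical f′ nz′ = vec-ext at
      where
      tri : ∀ t → lookup f′ (triArc t) ≡ lookup (extend (restrict f′)) (triArc t)
      tri t = trans (triangle-canonical f′ (proj₁ nz′) (proj₂ nz′) t)
        (trans (cong₂ (λ p q → triangleValue p q t) (sym (boundary-restrict f′ 0F)) (sym (boundary-restrict f′ 1F)))
               (sym (extend-triArc (restrict f′) t)))
      at : ∀ j → lookup f′ j ≡ lookup (extend (restrict f′)) j
      at 0F = tri 0F
      at 1F = tri 1F
      at 2F = tri 2F
      at (suc (suc (suc i))) = sym (trans (oldValues-extend (restrict f′) i) (pull-restrict f′ i))

    sixFlows′ : FlowGraphHasVertices es 6 → FlowGraphHasVertices expanded 6
    sixFlows′ (L , distinct , nz , complete) = Vec.map extend L ,
      (λ a b e → distinct a b (trans (sym (restrict-extend (lookup L a)))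
        (trans (cong restrict (trans (sym (Vec.lookup-map a extend L)) (trans e (Vec.lookup-map b extend L))))
               (restrict-extend (lookup L b))))) ,
      (λ a → subst (NZFlow expanded) (sym (Vec.lookup-map a extend L)) (extend-nzFlow (lookup L a) (nz a))) ,
      λ f′ nz′ → let (a , e) = complete (restrict f′) (restrict-nzFlow f′ nz′) in
        a , trans (Vec.lookup-map a extend L) (trans (cong extend e) (sym (canonical f′ nz′)))

    contract-cycle : ∀ {S S′} → (∀ i → oldBits S′ i ≡ lookup S (ρ i)) → (∃[ i ] InS es S i) →
                     IsCycleEdgeSet expanded S′ → IsCycleEdgeSet es S
    contract-cycle {S} {S′} old-bit nonempty (_ , degrees′ , connected′) = nonempty , degrees , connected
      where
      old-degS : ∀ y → oldDegS (lookup S ∘ ρ) y ≡ oldDegS (oldBits S′) y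
      old-degS y = Σℕ.sum-cong-≗ λ i → cong (λ b → if b then ends reattached i y else 0) (sym (old-bit i))
      degS′ : ∀ y → ZeroOrTwo (degS expanded S′ y)
      degS′ y = subst ZeroOrTwo (degIn≡degS expanded S′ y) (degrees′ y)
      o : Fin 3 → Bool
      o k = oldBits S′ (atV k)
      s : Fin 3 → Bool
      s t = lookup S′ (triArc t)
      at-V : ∀ k → oldDegS (lookup S ∘ ρ) (V k) ≡ 𝟙 (o k)
      at-V k = trans (old-degS (V k)) (oldDegS-V (oldBits S′) k)
      at-V′ : ∀ k {p} → degS expanded S′ (V k) ≡ p + oldDegS (oldBits S′) (V k) → ZeroOrTwo (p + 𝟙 (o k))
      at-V′ k {p} e = subst ZeroOrTwo (trans e (cong (p +_) (oldDegS-V (oldBits S′) k))) (degS′ (V k))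

      degrees : ∀ x → ZeroOrTwo (degIn es S x)
      degrees x rewrite degIn≡degS es S x with x ≟ v
      ... | no x≢v = subst ZeroOrTwo (sym (trans (degS-shift S x x≢v) (trans (old-degS (shift x)) (sym (degS-shift′ S′ x x≢v)))))
                       (degS′ (shift x))
      ... | yes refl = subst ZeroOrTwo (sym (trans (degS-v S) (cong₂ _+_ (at-V 0F) (cong₂ _+_ (at-V 1F) (at-V 2F)))))
        (triangle-parity (s 0F) (s 1F) (s 2F) (o 0F) (o 1F) (o 2F)
          (at-V′ 0F (degS-V₀ S′)) (at-V′ 1F (degS-V₁ S′)) (at-V′ 2F (degS-V₂ S′)))

      connected : Connected es S
      connected i₁ i₂ i₁∈ i₂∈ = subst₂ (Reach es S) (collapse-tl′ i₁) (collapse-tl′ i₂)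
        (contract {S} {S′} old-bit (connected′ (old (ρ⁻ i₁)) (old (ρ⁻ i₂)) (old-in {S} {S′} old-bit i₁∈) (old-in {S} {S′} old-bit i₂∈)))

    restrict-cycle : ∀ f′ g′ → NZFlow expanded f′ → NZFlow expanded g′ →
                     FlowAdj expanded f′ g′ → FlowAdj es (restrict f′) (restrict g′)
    restrict-cycle f′ g′ nzf′ nzg′ cycle′@((j , j∈S′) , _) = contract-cycle {S} {S′} old-bit nonempty cycle′
      where
      S = diffSupport es (restrict f′) (restrict g′)
      S′ = diffSupport expanded f′ g′
      old-bit : ∀ i → oldBits S′ i ≡ lookup S (ρ i)
      old-bit i = trans (lookup-diffSupport expanded f′ g′ (old i)) (sym (trans (lookup-diffSupport es (restrict f′) (restrict g′) (ρ i))
        (cong₂ (λ p q → not (does (p ≟ q))) (pull-restrict f′ i) (pull-restrict g′ i))))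
      nonempty : ∃[ i ] InS es S i
      nonempty = diffSupport-nonempty es (restrict f′) (restrict g′) λ same →
        let f′≡g′ = trans (canonical f′ nzf′) (trans (cong extend same) (sym (canonical g′ nzg′))) in
        case trans (sym (diffSupport-self expanded g′ j)) (subst (λ h → InS expanded (diffSupport expanded h g′) j) f′≡g′ j∈S′) of λ ()

    adjacent⇒neg′ : (∀ f g → NZFlow es f → NZFlow es g → FlowAdj es f g → g ≡ neg es f) →
                    ∀ f′ g′ → NZFlow expanded f′ → NZFlow expanded g′ → FlowAdj expanded f′ g′ → g′ ≡ neg expanded f′
    adjacent⇒neg′ adjacent⇒neg f′ g′ nzf′ nzg′ f′~g′ = begin
      g′                                   ≡⟨ canonical g′ nzg′ ⟩
      extend (restrict g′)                 ≡⟨ cong extend (adjacent⇒neg (restrict f′) (restrict g′)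
                                                 (restrict-nzFlow f′ nzf′) (restrict-nzFlow g′ nzg′)
                                                 (restrict-cycle f′ g′ nzf′ nzg′ f′~g′)) ⟩
      extend (neg es (restrict f′))        ≡⟨ cong extend (restrict-neg f′) ⟨
      extend (restrict (neg expanded f′))  ≡⟨ canonical (neg expanded f′) (neg-nzFlow expanded f′ nzf′) ⟨
      neg expanded f′                      ∎
      where open ≡-Reasoning

    oddSupport-fiber : ∀ f′ → NZFlow expanded f′ → ∀ y₁ y₂ → collapse y₁ ≡ collapse y₂ →
                       Reach expanded (oddSupport expanded f′) y₁ y₂
    oddSupport-fiber f′ nz′@(flow′ , nonzero′) y₁ y₂ e with collapse y₁ ≟ v
    ... | yes y₁↦v = Reach-trans expanded (to-V₀ y₁ y₁↦v) (Reach-sym expanded (to-V₀ y₂ (trans (sym e) y₁↦v)))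
      where
      boundary≢0 = boundary′-nonzero f′ nonzero′
      odd-triangle : ∃[ t ] ∀ u → u ≢ t → odd (triangleValue (boundary′ f′ 0F) (boundary′ f′ 1F) u) ≡ true
      odd-triangle = triangle-odd (boundary′ f′ 0F) (boundary′ f′ 1F) (boundary′ f′ 2F)
        (boundary≢0 0F) (boundary≢0 1F) (boundary≢0 2F) (boundary′-sum f′ flow′)
      odd-arcs : ∀ u → u ≢ proj₁ odd-triangle → InS expanded (oddSupport expanded f′) (triArc u)
      odd-arcs u u≢t = trans (lookup-oddSupport expanded f′ (triArc u))
        (trans (cong odd (triangle-canonical f′ flow′ nonzero′ u)) (proj₂ odd-triangle u u≢t))
      to-V₀ : ∀ y → collapse y ≡ v → Reach expanded (oddSupport expanded f′) y (V 0F)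
      to-V₀ zero _ = triangle-reach _ (proj₁ odd-triangle) odd-arcs 1F
      to-V₀ (suc zero) _ = triangle-reach _ (proj₁ odd-triangle) odd-arcs 2F
      to-V₀ (suc (suc x)) refl = here
    ... | no y₁↦̸v = subst (Reach expanded _ y₁) (collapse-injective y₁ y₂ e y₁↦̸v) here

    -- v lies on the odd support because the old arc at some Vₖ is odd
    oddSupport-at-v : ∀ f′ → NZFlow expanded f′ → let S = oddSupport es (restrict f′) in
                      ∃[ i ] InS es S i × Reach es S v (tl es i)
    oddSupport-at-v f′ (flow′ , nonzero′) = [ through 0F , through 1F ]′
      (boundary-odd (boundary′ f′ 0F) (boundary′ f′ 1F) (boundary′ f′ 2F) (boundary≢0 0F) (boundary≢0 1F) (boundary≢0 2F)
                    (boundary′-sum f′ flow′))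
      where
      S = oddSupport es (restrict f′)
      boundary≢0 = boundary′-nonzero f′ nonzero′
      through : ∀ k → odd (boundary′ f′ k) ≡ true → ∃[ i ] InS es S i × Reach es S v (tl es i)
      through k odd-k = ρ i , i∈S , reach (ends≡1⇒endpoint reattached i (V k) (proj₁ (proj₂ (atV-unique k))))
        where
        i = atV k
        i∈S : InS es S (ρ i)
        i∈S = trans (sym (oddSupport-old-bit f′ i)) (trans (lookup-oddSupport expanded f′ (old i))
                (trans (sym (odd-oldNet (oldValues f′) k)) odd-k))
        reach : tl reattached i ≡ V k ⊎ hd reattached i ≡ V k → Reach es S v (tl es (ρ i))
        reach (inj₁ tl≡V) = subst (λ z → Reach es S z (tl es (ρ i)))
          (trans (sym (collapse-tl i)) (trans (cong collapse tl≡V) (collapse-V k))) here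
        reach (inj₂ hd≡V) = subst (λ z → Reach es S z (tl es (ρ i)))
          (trans (sym (collapse-hd i)) (trans (cong collapse hd≡V) (collapse-V k))) (bwd (ρ i) i∈S here)

    adjacent-neg′ : (∀ f → NZFlow es f → FlowAdj es f (neg es f)) →
                    ∀ f′ → NZFlow expanded f′ → FlowAdj expanded f′ (neg expanded f′)
    adjacent-neg′ adjacent-neg f′ nz′ =
      (old (ρ⁻ i) , old-in {S} {S′} (oddSupport-old-bit f′) i∈S) ,
      oddSupport-degree expanded cubic′ f′ (proj₁ nz′) ,
      lift-connected {S} {S′} (oddSupport-old-bit f′) (oddSupport-fiber f′ nz′) (oddSupport-at-v f′ nz′) connected
      where
      S = oddSupport es (restrict f′)
      S′ = oddSupport expanded f′
      cycle : IsCycleEdgeSet es S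
      cycle = adjacent-neg (restrict f′) (restrict-nzFlow f′ nz′)
      i = proj₁ (proj₁ cycle)
      i∈S = proj₂ (proj₁ cycle)
      connected = proj₂ (proj₂ cycle)

  expansion-invariant : KleeInvariant es → KleeInvariant expanded
  expansion-invariant I = record
    { cubic = cubic′ I.cubic
    ; sixFlows = sixFlows′ I.cubic I.sixFlows
    ; adjacent⇒neg = adjacent⇒neg′ I.cubic I.adjacent⇒neg
    ; adjacent-neg = adjacent-neg′ I.cubic I.adjacent-neg }
    where module I = KleeInvariant I

-- K4

-- arcs of K4: 0F = 01, 1F = 02, 2F = 03, 3F = 12, 4F = 13, 5F = 23
K4-flows : Vec (Z4Map K4) 6
K4-flows = (z1 ∷ z1 ∷ z2 ∷ z2 ∷ z3 ∷ z3 ∷ [])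
         ∷ (z1 ∷ z2 ∷ z1 ∷ z3 ∷ z2 ∷ z1 ∷ [])
         ∷ (z2 ∷ z1 ∷ z1 ∷ z1 ∷ z1 ∷ z2 ∷ [])
         ∷ (z2 ∷ z3 ∷ z3 ∷ z3 ∷ z3 ∷ z2 ∷ [])
         ∷ (z3 ∷ z2 ∷ z3 ∷ z1 ∷ z2 ∷ z3 ∷ [])
         ∷ (z3 ∷ z3 ∷ z2 ∷ z2 ∷ z1 ∷ z1 ∷ [])
         ∷ []

private
  _≟ᵥ_ : DecidableEquality (Z4Map K4)
  _≟ᵥ_ = Vec.≡-dec _≟_

K4-cubic : ∀ x → deg K4 x ≡ 3
K4-cubic = from-yes (all? λ x → deg K4 x ℕ.≟ 3)

K4-distinct : ∀ a b → lookup K4-flows a ≡ lookup K4-flows b → a ≡ b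
K4-distinct = from-yes (all? λ a → all? λ b → (lookup K4-flows a ≟ᵥ lookup K4-flows b) →-dec (a ≟ b))

K4-nzFlows : ∀ a → NZFlow K4 (lookup K4-flows a)
K4-nzFlows = from-yes (all? λ a → nzFlow? K4 (lookup K4-flows a))

-- opaque, so that uses do not unfold the exhaustive search over all 4⁶ maps
opaque
  K4-complete : ∀ f → NZFlow K4 f → ∃[ a ] lookup K4-flows a ≡ f
  K4-complete = from-yes (∀-vec? λ f → nzFlow? K4 f →-dec any? λ a → lookup K4-flows a ≟ᵥ f)

K4-adjacent : ∀ a b → let S = diffSupport K4 (lookup K4-flows a) (lookup K4-flows b) in
  (∃[ i ] InS K4 S i) → (∀ x → ZeroOrTwo (degIn K4 S x)) → lookup K4-flows b ≡ neg K4 (lookup K4-flows a)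
K4-adjacent = from-yes (all? λ a → all? λ b →
  let S = diffSupport K4 (lookup K4-flows a) (lookup K4-flows b) in
  any? (λ i → lookup S i Bool.≟ true) →-dec all? (λ x → zeroOrTwo? (degIn K4 S x)) →-dec
  (lookup K4-flows b ≟ᵥ neg K4 (lookup K4-flows a)))

module _ (S : EdgeSet K4) where
  spanned-by-01-02-13 : InS K4 S 0F → InS K4 S 1F → InS K4 S 4F → ∀ x → Reach K4 S 0F x
  spanned-by-01-02-13 e01 e02 e13 0F = here
  spanned-by-01-02-13 e01 e02 e13 1F = fwd 0F e01 here
  spanned-by-01-02-13 e01 e02 e13 2F = fwd 1F e02 here
  spanned-by-01-02-13 e01 e02 e13 3F = fwd 0F e01 (fwd 4F e13 here)

  spanned-by-01-03-12 : InS K4 S 0F → InS K4 S 2F → InS K4 S 3F → ∀ x → Reach K4 S 0F x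
  spanned-by-01-03-12 e01 e03 e12 0F = here
  spanned-by-01-03-12 e01 e03 e12 1F = fwd 0F e01 here
  spanned-by-01-03-12 e01 e03 e12 2F = fwd 0F e01 (fwd 3F e12 here)
  spanned-by-01-03-12 e01 e03 e12 3F = fwd 2F e03 here

  spanned-by-02-03-12 : InS K4 S 1F → InS K4 S 2F → InS K4 S 3F → ∀ x → Reach K4 S 0F x
  spanned-by-02-03-12 e02 e03 e12 0F = here
  spanned-by-02-03-12 e02 e03 e12 1F = fwd 1F e02 (bwd 3F e12 here)
  spanned-by-02-03-12 e02 e03 e12 2F = fwd 1F e02 here
  spanned-by-02-03-12 e02 e03 e12 3F = fwd 2F e03 here

K4-oddSupport-cycle : ∀ a → IsCycleEdgeSet K4 (oddSupport K4 (lookup K4-flows a))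
K4-oddSupport-cycle a = nonempty a ,
  oddSupport-degree K4 K4-cubic (lookup K4-flows a) (proj₁ (K4-nzFlows a)) ,
  λ i j _ _ → Reach-from K4 0F (spanned a) (tl K4 i) (tl K4 j)
  where
  nonempty : ∀ a → ∃[ i ] InS K4 (oddSupport K4 (lookup K4-flows a)) i
  nonempty = from-yes (all? λ a → any? λ i → lookup (oddSupport K4 (lookup K4-flows a)) i Bool.≟ true)
  spanned : ∀ a → ∀ x → Reach K4 (oddSupport K4 (lookup K4-flows a)) 0F x
  spanned 0F = spanned-by-01-02-13 _ refl refl refl
  spanned 1F = spanned-by-01-03-12 _ refl refl refl
  spanned 2F = spanned-by-02-03-12 _ refl refl refl
  spanned 3F = spanned-by-02-03-12 _ refl refl refl
  spanned 4F = spanned-by-01-03-12 _ refl refl refl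
  spanned 5F = spanned-by-01-02-13 _ refl refl refl

K4-invariant : KleeInvariant K4
K4-invariant = record
  { cubic = K4-cubic
  ; sixFlows = K4-flows , K4-distinct , K4-nzFlows , K4-complete
  ; adjacent⇒neg = adjacent⇒neg
  ; adjacent-neg = adjacent-neg }
  where
  adjacent⇒neg : ∀ f g → NZFlow K4 f → NZFlow K4 g → FlowAdj K4 f g → g ≡ neg K4 f
  adjacent⇒neg f g nzf nzg (nonempty , degrees , _) with K4-complete f nzf | K4-complete g nzg
  ... | a , refl | b , refl = K4-adjacent a b nonempty degrees
  adjacent-neg : ∀ f → NZFlow K4 f → FlowAdj K4 f (neg K4 f)
  adjacent-neg f nzf with K4-complete f nzf
  ... | a , refl = K4-oddSupport-cycle a

klee-invariant : ∀ {n es} → Klee n es → KleeInvariant es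
klee-invariant k4 = K4-invariant
klee-invariant (expand {es = es} k v) =
  Iso-invariant (reorderIso (++-comm triangle reattached)) (expansion-invariant (klee-invariant k))
  where open Expansion es v
klee-invariant (relabel {es = es} k π) = Iso-invariant (relabelIso es π) (klee-invariant k)
klee-invariant (reorder k p) = Iso-invariant (reorderIso p) (klee-invariant k)
klee-invariant (reorient k p) = Iso-invariant (reorientIso p) (klee-invariant k)

mainTheorem12 : ∀ {n : ℕ} {es : Edges n} → Klee n es →
    FlowGraphHasVertices es 6 × FlowGraphOneRegular es
mainTheorem12 k = sixFlows , oneRegular
  where open KleeInvariant (klee-invariant k)
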